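{- (a) The graph $\Gamma(cS_n)$ is connected if and only if $n\le4$. (b) The connected component of the identity in $\Gamma(cS_n)$ consists exactly of the identity, all transpositions, and all cycles (of length $\ge3$) that can be reduced by a finite sequence of reduction moves to a $3$-cycle. (c) Every other connected component of $\Gamma(cS_n)$ consists exactly of all cycles that can be reduced by a finite (possibly empty) sequence of reduction moves to a given irreducible cycle $(a_1,\dots,a_s)$.
   Context: Permutations act on $[n]$; products composed right to left; $\tau_i=(i,i+1)$. $cS_n\subseteq\Sigma_n$ is the set of permutations whose disjoint cycle decomposition contains at most one cycle of length $\ge2$ (the identity and single cycles). $\Gamma(cS_n)$ is the induced subgraph of the Cayley graph of $\Sigma_n$ with respect to $\tau_1,\dots,\tau_{n-1}$: vertices $cS_n$, edge $a$—$b$ whenever $b=a\tau_i$ for some $i$. A cycle $c=(c_1,c_2,\dots,c_k)$ is viewed as a cyclic sequence (indices mod $k$). A reduction move applies when $k\ge4$: if for some $t$ no element of $c$ lies strictly between $c_t$ and $c_{t+1}$, replace $c$ by the cycle obtained by deleting $c_{t+1}$, i.e. $(c_1,\dots,c_t,c_{t+2},\dots,c_k)$. A cycle $(a_1,\dots,a_s)$ with $s\ge4$ is irreducible if for every $i$ (cyclically) some other element $a_j$ lies strictly between $a_i$ and $a_{i+1}$, i.e. no reduction move applies. -}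

module Defs where

open import Data.Nat using (ℕ; zero; suc; _≤_)
open import Data.Fin using (Fin; toℕ) renaming (_<_ to _<ᶠ_)
open import Data.Fin.Properties using (_≟_)
open import Data.Bool using (if_then_else_)
open import Data.List using (List; []; _∷_; _++_; length)
open import Data.List.Relation.Unary.Any using (Any)
open import Data.List.Relation.Unary.Unique.Propositional using (Unique)
open import Data.Product using (Σ; ∃; _×_; _,_)
open import Data.Sum using (_⊎_)
open import Relation.Nullary using (¬_; does)
open import Relation.Binary.PropositionalEquality using (_≡_)
open import Relation.Binary.Construct.Closure.ReflexiveTransitive using (Star)

-- Permutations of [n] = Fin n (0-indexed), as functions; compared pointwise.
Perm : ℕ → Set
Perm n = Fin n → Fin n

_≈ₚ_ : ∀ {n} → Perm n → Perm n → Set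
σ ≈ₚ ρ = ∀ x → σ x ≡ ρ x

idP : ∀ {n} → Perm n
idP x = x

_∘ₚ_ : ∀ {n} → Perm n → Perm n → Perm n
(σ ∘ₚ ρ) x = σ (ρ x)

swap : ∀ {n} → Fin n → Fin n → Perm n
swap i j x = if does (x ≟ i) then j else (if does (x ≟ j) then i else x)

-- the cycle (c₁,…,c_k): c₁ ↦ c₂ ↦ … ↦ c_k ↦ c₁, all other points fixed
cycNext : ∀ {n} → Fin n → List (Fin n) → Perm n
cycNext f [] x = x
cycNext f (a ∷ []) x = if does (x ≟ a) then f else x
cycNext f (a ∷ b ∷ rest) x = if does (x ≟ a) then b else cycNext f (b ∷ rest) x

cyc : ∀ {n} → List (Fin n) → Perm n
cyc [] = idP
cyc (a ∷ rest) = cycNext a (a ∷ rest)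

IsCycleList : ∀ {n} → List (Fin n) → Set
IsCycleList c = Unique c × 2 ≤ length c

InCS : ∀ {n} → Perm n → Set
InCS {n} σ = σ ≈ₚ idP ⊎ Σ (List (Fin n)) (λ c → IsCycleList c × σ ≈ₚ cyc c)

-- edges of the Cayley graph w.r.t. adjacent transpositions τ_i = (i, i+1):  b = a τ_i
Edge : ∀ {n} → Perm n → Perm n → Set
Edge {n} a b = Σ (Fin n) λ i → Σ (Fin n) λ j → toℕ j ≡ suc (toℕ i) × b ≈ₚ (a ∘ₚ swap i j)

-- walks in the induced subgraph Γ(cS_n) (all intermediate vertices lie in cS_n)
data Reach {n} : Perm n → Perm n → Set where
  here : ∀ {a b} → a ≈ₚ b → Reach a b
  step : ∀ {a b c} → InCS b → Edge a b → Reach b c → Reach a c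

GammaConnected : ℕ → Set
GammaConnected n = ∀ (a b : Perm n) → InCS a → InCS b → Reach a b

StrictlyBetween : ∀ {n} → Fin n → Fin n → Fin n → Set
StrictlyBetween a x b = (a <ᶠ x × x <ᶠ b) ⊎ (b <ᶠ x × x <ᶠ a)

SomeBetween : ∀ {n} → List (Fin n) → Fin n → Fin n → Set
SomeBetween c a b = Any (λ x → StrictlyBetween a x b) c

-- reduction move: delete c_{t+1} when no element of c lies strictly between c_t and c_{t+1}
-- (cyclic indices: either consecutive in the list, or t = last and t+1 = first)
data Move {n} (c : List (Fin n)) : List (Fin n) → Set where
  inner : ∀ xs a b ys → c ≡ xs ++ a ∷ b ∷ ys → ¬ SomeBetween c a b → 4 ≤ length c →
          Move c (xs ++ a ∷ ys)
  wrap  : ∀ b ys a → c ≡ b ∷ ys ++ a ∷ [] → ¬ SomeBetween c a b → 4 ≤ length c →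
          Move c (ys ++ a ∷ [])

ReducesTo : ∀ {n} → List (Fin n) → List (Fin n) → Set
ReducesTo = Star Move

data CycAdj {n} (d : List (Fin n)) : Fin n → Fin n → Set where
  inner : ∀ xs a b ys → d ≡ xs ++ a ∷ b ∷ ys → CycAdj d a b
  wrap  : ∀ b ys a → d ≡ b ∷ ys ++ a ∷ [] → CycAdj d a b

Irreducible : ∀ {n} → List (Fin n) → Set
Irreducible d = Unique d × 4 ≤ length d × (∀ a b → CycAdj d a b → SomeBetween d a b)

-- An adjacent transposition τ = (i, i+1) takes a cycle c to an element of cS_n only in two ways: τ
-- deletes an entry q of c whose predecessor p is a value next to q, or it inserts such a q right
-- after p. As no entry lies strictly between consecutive values, such a deletion from a cycle of
-- length ≥ 4 is a reduction move, and conversely every reduction move is realised by a walk that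
-- inserts and deletes the intermediate values one at a time. Reduction moves are confluent, except
-- that a 4-cycle may collapse to two different 3-cycles, so along any walk the irreducible normal
-- form of a cycle is invariant, while the transpositions and the cycles reducing to 3-cycles form
-- one component together with the identity. For n ≤ 4 an irreducible cycle would contain three
-- distinct entries each differing by at least 2 from both neighbours, which forces all three to be
-- 0 or 3; for n ≥ 5 the cycle (0 2 4 1 3) is irreducible.

module Submission where

open import Defs
open import Data.Nat using (ℕ; zero; suc; _≤_; _<_; s≤s; z≤n; _+_)
import Data.Nat as ℕ
import Data.Nat.Properties as ℕ
open import Data.Fin using (Fin; toℕ; fromℕ<; #_) renaming (_<_ to _<ᶠ_)
open import Data.Fin.Properties using (_≟_; toℕ-injective; <-cmp; _<?_; toℕ-fromℕ<; toℕ<n)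
open import Data.List using (List; []; _∷_; _++_; _∷ʳ_; length; [_]; filter; initLast; _∷ʳ′_)
open import Data.List.Properties
  using (++-assoc; length-++; ++-identityʳ; filter-++; filter-accept; filter-reject; ∷-injectiveˡ; ∷-injectiveʳ; ∷ʳ-injective)
open import Data.List.Relation.Unary.Any using (here; there; any?)
open import Data.List.Relation.Unary.All using (All; []; _∷_; lookup)
import Data.List.Relation.Unary.Any.Properties as Any
open import Data.List.Relation.Unary.All.Properties using (¬Any⇒All¬; All¬⇒¬Any) renaming (++⁻ˡ to All-++⁻ˡ)
open import Data.List.Relation.Unary.AllPairs using ([]; _∷_)
open import Data.List.Relation.Unary.Unique.Propositional using (Unique)
open import Data.List.Relation.Unary.Unique.Propositional.Properties
  using (Unique[x∷xs]⇒x∉xs) renaming (++⁺ to Unique-++⁺; filter⁺ to Unique-filter⁺)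
import Data.List.Relation.Unary.Unique.DecPropositional as UniqueDec
open import Data.List.Relation.Binary.Disjoint.Propositional using (Disjoint)
open import Data.List.Membership.Propositional using (_∈_; _∉_; find; lose)
open import Data.List.Membership.Propositional.Properties
  using (∈-++⁺ˡ; ∈-++⁺ʳ; ∈-++⁻; ∈-∃++; ∈-filter⁺; ∈-filter⁻)
open import Data.Product using (Σ; _×_; _,_; proj₁; proj₂)
open import Data.Sum using (_⊎_; inj₁; inj₂; [_,_]′)
import Data.Sum as Sum
open import Data.Empty using (⊥; ⊥-elim)
open import Relation.Nullary using (¬_; yes; no; Dec; ¬?)
open import Relation.Nullary.Decidable using (_×-dec_; _⊎-dec_; from-yes)
open import Relation.Binary using (tri<; tri≈; tri>)
open import Relation.Binary.PropositionalEquality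
  using (_≡_; _≢_; refl; sym; trans; cong; subst; subst₂; module ≡-Reasoning)
open import Relation.Binary.Construct.Closure.ReflexiveTransitive using (ε; _◅_)
open import Induction.WellFounded using (Acc; acc)
open import Data.Nat.Induction using (<-wellFounded)
open import Function.Base using (_∘_)
open import Function.Bundles using (_⇔_; mk⇔)

module _ {a} {A : Set a} where

  Unique-++⁻ʳ : ∀ xs {ys : List A} → Unique (xs ++ ys) → Unique ys
  Unique-++⁻ʳ []       u       = u
  Unique-++⁻ʳ (_ ∷ xs) (_ ∷ u) = Unique-++⁻ʳ xs u

  Unique-++⁻ˡ : ∀ xs {ys : List A} → Unique (xs ++ ys) → Unique xs
  Unique-++⁻ˡ []       _       = []
  Unique-++⁻ˡ (_ ∷ xs) (p ∷ u) = All-++⁻ˡ xs p ∷ Unique-++⁻ˡ xs u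

  Unique-++⇒Disjoint : ∀ xs {ys : List A} → Unique (xs ++ ys) → Disjoint xs ys
  Unique-++⇒Disjoint (_ ∷ xs) (p ∷ _) (here refl , v∈ys)  = All¬⇒¬Any p (∈-++⁺ʳ xs v∈ys)
  Unique-++⇒Disjoint (_ ∷ xs) (_ ∷ u) (there v∈xs , v∈ys) = Unique-++⇒Disjoint xs u (v∈xs , v∈ys)

  Unique-++-comm : ∀ xs {ys : List A} → Unique (xs ++ ys) → Unique (ys ++ xs)
  Unique-++-comm xs u = Unique-++⁺ (Unique-++⁻ʳ xs u) (Unique-++⁻ˡ xs u)
    (λ (v∈ys , v∈xs) → Unique-++⇒Disjoint xs u (v∈xs , v∈ys))

  Unique-mid-∉ˡ : ∀ xs {x : A} {ys} → Unique (xs ++ x ∷ ys) → x ∉ xs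
  Unique-mid-∉ˡ xs u x∈xs = Unique-++⇒Disjoint xs u (x∈xs , here refl)

  Unique-mid-∉ʳ : ∀ xs {x : A} {ys} → Unique (xs ++ x ∷ ys) → x ∉ ys
  Unique-mid-∉ʳ xs u = Unique[x∷xs]⇒x∉xs (Unique-++⁻ʳ xs u)

  Unique-drop₂ : ∀ {x y : A} {zs} → Unique (x ∷ y ∷ zs) → Unique (x ∷ zs)
  Unique-drop₂ ((_ ∷ p) ∷ _ ∷ u) = p ∷ u

  Unique-drop-next : ∀ xs {p q : A} {ys} → Unique (xs ++ p ∷ q ∷ ys) → Unique (xs ++ p ∷ ys)
  Unique-drop-next []       u       = Unique-drop₂ u
  Unique-drop-next (_ ∷ xs) (p ∷ u) = dropAll xs p ∷ Unique-drop-next xs u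
    where
    dropAll : ∀ {P : A → Set a} {p q ys} zs → All P (zs ++ p ∷ q ∷ ys) → All P (zs ++ p ∷ ys)
    dropAll []       (b ∷ _ ∷ c) = b ∷ c
    dropAll (_ ∷ zs) (b ∷ c)     = b ∷ dropAll zs c

  Unique-insert : ∀ xs {p q : A} {ys} → Unique (xs ++ p ∷ ys) → q ∉ xs ++ p ∷ ys →
                  Unique (xs ++ p ∷ q ∷ ys)
  Unique-insert [] {ys = ys} (p ∷ u) q∉ =
    ((λ p≡q → q∉ (here (sym p≡q))) ∷ p) ∷ ¬Any⇒All¬ ys (λ q∈ys → q∉ (there q∈ys)) ∷ u
  Unique-insert (_ ∷ xs) (p ∷ u) q∉ =
    insertAll xs (λ x≡q → q∉ (here (sym x≡q))) p ∷ Unique-insert xs u (λ q∈ → q∉ (there q∈))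
    where
    insertAll : ∀ {x q p ys} zs → x ≢ q → All (x ≢_) (zs ++ p ∷ ys) → All (x ≢_) (zs ++ p ∷ q ∷ ys)
    insertAll []       x≢q (b ∷ c) = b ∷ x≢q ∷ c
    insertAll (_ ∷ zs) x≢q (b ∷ c) = b ∷ insertAll zs x≢q c

-- Cycles as permutations

module _ {n : ℕ} where
  private
    A = Fin n

  ≈ₚ-refl : {σ : Perm n} → σ ≈ₚ σ
  ≈ₚ-refl _ = refl

  ≈ₚ-sym : {σ ρ : Perm n} → σ ≈ₚ ρ → ρ ≈ₚ σ
  ≈ₚ-sym p x = sym (p x)

  ≈ₚ-trans : {σ ρ τ : Perm n} → σ ≈ₚ ρ → ρ ≈ₚ τ → σ ≈ₚ τ
  ≈ₚ-trans p q x = trans (p x) (q x)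

  headOr : A → List A → A
  headOr d []      = d
  headOr _ (x ∷ _) = x

  headOr-++ : ∀ (d : A) xs p zs → headOr d (xs ++ p ∷ zs) ≡ headOr p xs
  headOr-++ d []      p zs = refl
  headOr-++ d (_ ∷ _) p zs = refl

  headOr-∷ʳ : ∀ (d x : A) xs → headOr d (xs ++ [ x ]) ≡ headOr x xs
  headOr-∷ʳ d x xs = headOr-++ d xs x []

  headOr-∈ : ∀ (i : A) xs → headOr i xs ∈ xs ++ [ i ]
  headOr-∈ i []      = here refl
  headOr-∈ i (_ ∷ _) = here refl

  headOr-∈-nonempty : ∀ (d : A) {c} → 2 ≤ length c → headOr d c ∈ c
  headOr-∈-nonempty d {_ ∷ _} _ = here refl

  cycNext-skip : ∀ (f a : A) l {x} → x ≢ a → cycNext f (a ∷ l) x ≡ cycNext f l x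
  cycNext-skip f a []      {x} x≢a with x ≟ a
  ... | yes x≡a = ⊥-elim (x≢a x≡a)
  ... | no _    = refl
  cycNext-skip f a (_ ∷ _) {x} x≢a with x ≟ a
  ... | yes x≡a = ⊥-elim (x≢a x≡a)
  ... | no _    = refl

  cycNext-∉ : ∀ (f : A) l {x} → x ∉ l → cycNext f l x ≡ x
  cycNext-∉ f []      x∉ = refl
  cycNext-∉ f (a ∷ l) x∉ = trans (cycNext-skip f a l (x∉ ∘ here)) (cycNext-∉ f l (x∉ ∘ there))

  cycNext-++-∉ : ∀ (f : A) xs zs {x} → x ∉ xs → cycNext f (xs ++ zs) x ≡ cycNext f zs x
  cycNext-++-∉ f []       zs x∉ = refl
  cycNext-++-∉ f (a ∷ xs) zs x∉ =
    trans (cycNext-skip f a (xs ++ zs) (x∉ ∘ here)) (cycNext-++-∉ f xs zs (x∉ ∘ there))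

  cycNext-head : ∀ (f x : A) zs → cycNext f (x ∷ zs) x ≡ headOr f zs
  cycNext-head f x [] with x ≟ x
  ... | yes _   = refl
  ... | no x≢x = ⊥-elim (x≢x refl)
  cycNext-head f x (_ ∷ _) with x ≟ x
  ... | yes _   = refl
  ... | no x≢x = ⊥-elim (x≢x refl)

  cyc-cycNext : ∀ c (d x : A) → cyc c x ≡ cycNext (headOr d c) c x
  cyc-cycNext []      d x = refl
  cyc-cycNext (_ ∷ _) d x = refl

  cyc-∉ : ∀ c {x : A} → x ∉ c → cyc c x ≡ x
  cyc-∉ c {x} x∉ = trans (cyc-cycNext c x x) (cycNext-∉ _ c x∉)

  -- The image of x is the element after it, wrapping round to the head of the list.
  cyc-at : ∀ xs (x : A) zs → x ∉ xs → cyc (xs ++ x ∷ zs) x ≡ headOr (headOr x xs) zs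
  cyc-at xs x zs x∉xs = begin
    cyc (xs ++ x ∷ zs) x                                   ≡⟨ cyc-cycNext (xs ++ x ∷ zs) x x ⟩
    cycNext (headOr x (xs ++ x ∷ zs)) (xs ++ x ∷ zs) x   ≡⟨ cycNext-++-∉ _ xs (x ∷ zs) x∉xs ⟩
    cycNext (headOr x (xs ++ x ∷ zs)) (x ∷ zs) x         ≡⟨ cycNext-head _ x zs ⟩
    headOr (headOr x (xs ++ x ∷ zs)) zs                  ≡⟨ cong (λ h → headOr h zs) (headOr-++ x xs x zs) ⟩
    headOr (headOr x xs) zs                              ∎
    where open ≡-Reasoning

  cyc-at-≡ : ∀ {c} xs (x : A) zs → c ≡ xs ++ x ∷ zs → Unique c → cyc c x ≡ headOr (headOr x xs) zs
  cyc-at-≡ xs x zs refl u = cyc-at xs x zs (Unique-mid-∉ˡ xs u)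

  CycAdj⇒cyc : ∀ {c} {u v : A} → Unique c → CycAdj c u v → cyc c u ≡ v
  CycAdj⇒cyc u (inner xs a b ys refl) = cyc-at xs a (b ∷ ys) (Unique-mid-∉ˡ xs u)
  CycAdj⇒cyc u (wrap b ys a refl)     = cyc-at (b ∷ ys) a [] (Unique-mid-∉ˡ (b ∷ ys) u)

  cyc-CycAdj : ∀ {c} {u : A} → Unique c → 2 ≤ length c → u ∈ c → CycAdj c u (cyc c u)
  cyc-CycAdj {u = u} uc len u∈c with ∈-∃++ u∈c
  ... | xs , y ∷ ys , refl rewrite cyc-at xs u (y ∷ ys) (Unique-mid-∉ˡ xs uc) = inner xs u y ys refl
  ... | b ∷ xs , [] , refl rewrite cyc-at (b ∷ xs) u [] (Unique-mid-∉ˡ (b ∷ xs) uc) = wrap b xs u refl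
  ... | [] , [] , refl with s≤s () ← len

  CycAdj-∈ : ∀ {c} {p q : A} → CycAdj c p q → p ∈ c × q ∈ c
  CycAdj-∈ (inner xs a b ys refl) = ∈-++⁺ʳ xs (here refl) , ∈-++⁺ʳ xs (there (here refl))
  CycAdj-∈ (wrap b ys a refl)     = there (∈-++⁺ʳ ys (here refl)) , here refl

  CycAdj-≢ : ∀ {c} {p q : A} → Unique c → CycAdj c p q → p ≢ q
  CycAdj-≢ u (inner xs a b ys refl) p≡q = Unique-mid-∉ʳ xs u (here p≡q)
  CycAdj-≢ u (wrap b ys a refl)     refl = Unique[x∷xs]⇒x∉xs u (∈-++⁺ʳ ys (here refl))

  cyc-moves : ∀ {c} {u : A} → Unique c → 2 ≤ length c → u ∈ c → cyc c u ≢ u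
  cyc-moves uc len u∈c e = CycAdj-≢ uc (cyc-CycAdj uc len u∈c) (sym e)

  cyc-support : ∀ c {u : A} → cyc c u ≢ u → u ∈ c
  cyc-support c {u} moved with any? (u ≟_) c
  ... | yes u∈c = u∈c
  ... | no u∉c  = ⊥-elim (moved (cyc-∉ c u∉c))

  cyc-singleton : ∀ (p : A) → cyc [ p ] ≈ₚ idP
  cyc-singleton p x with x ≟ p
  ... | yes refl = refl
  ... | no _     = refl

  cyc-length-1 : ∀ (l : List A) → length l ≡ 1 → cyc l ≈ₚ idP
  cyc-length-1 (p ∷ []) _ = cyc-singleton p

  cyc-InCS : ∀ (l : List A) → Unique l → InCS (cyc l)
  cyc-InCS []          _ = inj₁ ≈ₚ-refl
  cyc-InCS (p ∷ [])    _ = inj₁ (cyc-singleton p)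
  cyc-InCS (p ∷ q ∷ l) u = inj₂ (p ∷ q ∷ l , (u , s≤s (s≤s z≤n)) , ≈ₚ-refl)

  cyc-≉id : ∀ {c} → IsCycleList c → ¬ (idP ≈ₚ cyc c)
  cyc-≉id {x ∷ _} (u , len) id≈c = cyc-moves u len (here refl) (sym (id≈c x))

  cyc-rotate₁ : ∀ (x : A) l → Unique (x ∷ l) → cyc (x ∷ l) ≈ₚ cyc (l ++ [ x ])
  cyc-rotate₁ x l u y with any? (y ≟_) (x ∷ l)
  ... | yes (here refl) = trans (cyc-at [] y l (λ ())) (sym (cyc-at l y [] (Unique[x∷xs]⇒x∉xs u)))
  ... | yes (there y∈l) with ∈-∃++ y∈l
  ...   | l₁ , l₂ , refl = begin
    cyc (x ∷ l₁ ++ y ∷ l₂) y            ≡⟨ cyc-at (x ∷ l₁) y l₂ (Unique-mid-∉ˡ (x ∷ l₁) u) ⟩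
    headOr x l₂                          ≡⟨ headOr-∷ʳ _ x l₂ ⟨
    headOr (headOr y l₁) (l₂ ++ [ x ])   ≡⟨ cyc-at-≡ l₁ y (l₂ ++ [ x ]) (++-assoc l₁ (y ∷ l₂) [ x ]) u′ ⟨
    cyc ((l₁ ++ y ∷ l₂) ++ [ x ]) y      ∎
    where
    open ≡-Reasoning
    u′ = Unique-++-comm [ x ] u
  cyc-rotate₁ x l u y | no y∉ = trans (cyc-∉ (x ∷ l) y∉) (sym (cyc-∉ (l ++ [ x ]) y∉′))
    where
    y∉′ : y ∉ l ++ [ x ]
    y∉′ y∈ = [ y∉ ∘ there , (λ { (here y≡x) → y∉ (here y≡x) }) ]′ (∈-++⁻ l y∈)

  cyc-rotate : ∀ xs ys → Unique (xs ++ ys) → cyc (xs ++ ys) ≈ₚ cyc (ys ++ xs)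
  cyc-rotate []       ys u y = cong (λ l → cyc l y) (sym (++-identityʳ ys))
  cyc-rotate (x ∷ xs) ys u y = begin
    cyc (x ∷ xs ++ ys) y          ≡⟨ cyc-rotate₁ x (xs ++ ys) u y ⟩
    cyc ((xs ++ ys) ++ [ x ]) y   ≡⟨ cong (λ l → cyc l y) (++-assoc xs ys [ x ]) ⟩
    cyc (xs ++ ys ++ [ x ]) y     ≡⟨ cyc-rotate xs (ys ++ [ x ]) u′ y ⟩
    cyc ((ys ++ [ x ]) ++ xs) y   ≡⟨ cong (λ l → cyc l y) (++-assoc ys [ x ] xs) ⟩
    cyc (ys ++ x ∷ xs) y          ∎
    where
    open ≡-Reasoning
    u′ = subst Unique (++-assoc xs ys [ x ]) (Unique-++-comm [ x ] u)

  cyc-maps-arc : ∀ (j : A) as i bs {x} → Unique (j ∷ as ++ i ∷ bs) → x ∈ as →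
                 cyc (j ∷ as ++ i ∷ bs) x ∈ as ++ [ i ]
  cyc-maps-arc j as i bs {x} u x∈as with ∈-∃++ x∈as
  ... | as₁ , as₂ , refl =
    subst (_∈ (as₁ ++ x ∷ as₂) ++ [ i ]) (sym image)
      (subst (headOr i as₂ ∈_) (sym (++-assoc as₁ (x ∷ as₂) [ i ])) (∈-++⁺ʳ as₁ (there (headOr-∈ i as₂))))
    where
    image : cyc (j ∷ (as₁ ++ x ∷ as₂) ++ i ∷ bs) x ≡ headOr i as₂
    image = trans (cyc-at-≡ (j ∷ as₁) x (as₂ ++ i ∷ bs) (cong (j ∷_) (++-assoc as₁ (x ∷ as₂) (i ∷ bs))) u)
                  (headOr-++ _ as₂ i bs)

  closed-suffix : ∀ (P : A → Set) {c} → Unique c → (∀ x → P x → P (cyc c x)) →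
                  ∀ pre u rest → c ≡ pre ++ u ∷ rest → P u → All P (u ∷ rest)
  closed-suffix P uc closed pre u []       eq pu = pu ∷ []
  closed-suffix P uc closed pre u (v ∷ rest) eq pu =
    pu ∷ closed-suffix P uc closed (pre ++ [ u ]) v rest (trans eq (sym (++-assoc pre [ u ] (v ∷ rest))))
           (subst P (cyc-at-≡ pre u (v ∷ rest) eq uc) (closed u pu))

  closed-cycle : ∀ (P : A → Set) {c} → Unique c → (∀ x → P x → P (cyc c x)) →
                 ∀ {x} → x ∈ c → P x → ∀ {y} → y ∈ c → P y
  closed-cycle P uc closed x∈c px y∈c with ∈-∃++ x∈c
  ... | xs , ys , refl = lookup (closed-suffix P (Unique-++-comm xs uc) closed′ [] _ (ys ++ xs) refl px)
                           (Any.++-comm xs (_ ∷ ys) y∈c)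
    where
    closed′ : ∀ x → P x → P (cyc (_ ∷ ys ++ xs) x)
    closed′ x px = subst P (cyc-rotate xs (_ ∷ ys) uc x) (closed x px)

-- Transpositions, deletion and insertion

module _ {n : ℕ} where
  private
    A = Fin n

  swap-≡ˡ : ∀ (i j : A) → swap i j i ≡ j
  swap-≡ˡ i j with i ≟ i
  ... | yes _   = refl
  ... | no i≢i = ⊥-elim (i≢i refl)

  swap-≡ʳ : ∀ (i j : A) → i ≢ j → swap i j j ≡ i
  swap-≡ʳ i j i≢j with j ≟ i
  ... | yes j≡i = ⊥-elim (i≢j (sym j≡i))
  ... | no _ with j ≟ j
  ...   | yes _   = refl
  ...   | no j≢j = ⊥-elim (j≢j refl)

  swap-other : ∀ (i j x : A) → x ≢ i → x ≢ j → swap i j x ≡ x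
  swap-other i j x x≢i x≢j with x ≟ i
  ... | yes x≡i = ⊥-elim (x≢i x≡i)
  ... | no _ with x ≟ j
  ...   | yes x≡j = ⊥-elim (x≢j x≡j)
  ...   | no _    = refl

  swap-comm : ∀ (i j : A) → swap i j ≈ₚ swap j i
  swap-comm i j x with x ≟ i | x ≟ j
  ... | yes refl | yes refl = refl
  ... | yes refl | no _     = refl
  ... | no _     | yes refl = refl
  ... | no _     | no _     = refl

  swap-involutive : ∀ (i j : A) → i ≢ j → (swap i j ∘ₚ swap i j) ≈ₚ idP
  swap-involutive i j i≢j x with x ≟ i
  ... | yes refl = swap-≡ʳ x j i≢j
  ... | no x≢i with x ≟ j
  ...   | yes refl = swap-≡ˡ i x
  ...   | no x≢j   = swap-other i j x x≢i x≢j

  cyc-delete-head : ∀ (p q : A) zs → Unique (p ∷ q ∷ zs) → (cyc (p ∷ q ∷ zs) ∘ₚ swap p q) ≈ₚ cyc (p ∷ zs)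
  cyc-delete-head p q zs u x with x ≟ p
  ... | yes refl = trans (cyc-at [ x ] q zs (Unique-mid-∉ˡ [ x ] u)) (sym (cyc-at [] x zs λ ()))
  ... | no x≢p with x ≟ q
  ...   | yes refl = trans (cyc-at [] p (x ∷ zs) λ ())
                       (sym (cyc-∉ (p ∷ zs) λ { (here x≡p) → x≢p x≡p
                                              ; (there x∈zs) → Unique-mid-∉ʳ [ p ] u x∈zs }))
  ...   | no x≢q with any? (x ≟_) zs
  ...     | yes x∈zs with ∈-∃++ x∈zs
  ...       | z₁ , z₂ , refl = trans (cyc-at (p ∷ q ∷ z₁) x z₂ (Unique-mid-∉ˡ (p ∷ q ∷ z₁) u))
                                 (sym (cyc-at (p ∷ z₁) x z₂ (Unique-mid-∉ˡ (p ∷ z₁) (Unique-drop₂ u))))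
  cyc-delete-head p q zs u x | no x≢p | no x≢q | no x∉zs =
    trans (cyc-∉ (p ∷ q ∷ zs) λ { (here e) → x≢p e ; (there (here e)) → x≢q e ; (there (there m)) → x∉zs m })
      (sym (cyc-∉ (p ∷ zs) λ { (here e) → x≢p e ; (there m) → x∉zs m }))

  cyc-delete : ∀ xs (p q : A) ys → Unique (xs ++ p ∷ q ∷ ys) →
               (cyc (xs ++ p ∷ q ∷ ys) ∘ₚ swap p q) ≈ₚ cyc (xs ++ p ∷ ys)
  cyc-delete xs p q ys u x = begin
    cyc (xs ++ p ∷ q ∷ ys) (swap p q x)   ≡⟨ cyc-rotate xs (p ∷ q ∷ ys) u (swap p q x) ⟩
    cyc (p ∷ q ∷ ys ++ xs) (swap p q x)   ≡⟨ cyc-delete-head p q (ys ++ xs) u′ x ⟩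
    cyc (p ∷ ys ++ xs) x                  ≡⟨ cyc-rotate (p ∷ ys) xs (Unique-drop₂ u′) x ⟩
    cyc (xs ++ p ∷ ys) x                  ∎
    where
    open ≡-Reasoning
    u′ = Unique-++-comm xs u

  cyc-insert : ∀ xs (p q : A) ys → Unique (xs ++ p ∷ ys) → q ∉ xs ++ p ∷ ys →
               cyc (xs ++ p ∷ q ∷ ys) ≈ₚ (cyc (xs ++ p ∷ ys) ∘ₚ swap p q)
  cyc-insert xs p q ys u q∉ x = begin
    cyc (xs ++ p ∷ q ∷ ys) x                ≡⟨ cong (cyc (xs ++ p ∷ q ∷ ys)) (swap-involutive p q p≢q x) ⟨
    cyc (xs ++ p ∷ q ∷ ys) (swap p q (swap p q x))
                                            ≡⟨ cyc-delete xs p q ys (Unique-insert xs u q∉) (swap p q x) ⟩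
    cyc (xs ++ p ∷ ys) (swap p q x)         ∎
    where
    open ≡-Reasoning
    p≢q : p ≢ q
    p≢q refl = q∉ (∈-++⁺ʳ xs (here refl))

  delete : A → List A → List A
  delete q = filter (λ x → ¬? (x ≟ q))

  delete-∷-≡ : ∀ {q x : A} l → x ≡ q → delete q (x ∷ l) ≡ delete q l
  delete-∷-≡ {q} l x≡q = filter-reject (λ y → ¬? (y ≟ q)) (λ x≢q → x≢q x≡q)

  delete-∷-≢ : ∀ {q x : A} l → x ≢ q → delete q (x ∷ l) ≡ x ∷ delete q l
  delete-∷-≢ {q} l = filter-accept (λ y → ¬? (y ≟ q))

  delete-∉ : ∀ (q : A) l → q ∉ l → delete q l ≡ l
  delete-∉ q []      q∉ = refl
  delete-∉ q (x ∷ l) q∉ =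
    trans (delete-∷-≢ l (λ x≡q → q∉ (here (sym x≡q)))) (cong (x ∷_) (delete-∉ q l (q∉ ∘ there)))

  delete-++-∉ : ∀ (q : A) xs ys → q ∉ xs → delete q (xs ++ ys) ≡ xs ++ delete q ys
  delete-++-∉ q xs ys q∉ = trans (filter-++ _ xs ys) (cong (_++ delete q ys) (delete-∉ q xs q∉))

  delete-head : ∀ (q : A) ys → q ∉ ys → delete q (q ∷ ys) ≡ ys
  delete-head q ys q∉ = trans (delete-∷-≡ ys refl) (delete-∉ q ys q∉)

  delete-mid : ∀ xs (q : A) ys → Unique (xs ++ q ∷ ys) → delete q (xs ++ q ∷ ys) ≡ xs ++ ys
  delete-mid xs q ys u =
    trans (delete-++-∉ q xs (q ∷ ys) (Unique-mid-∉ˡ xs u)) (cong (xs ++_) (delete-head q ys (Unique-mid-∉ʳ xs u)))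

  delete-next : ∀ xs (p q : A) ys → Unique (xs ++ p ∷ q ∷ ys) → delete q (xs ++ p ∷ q ∷ ys) ≡ xs ++ p ∷ ys
  delete-next xs p q ys u = begin
    delete q (xs ++ p ∷ q ∷ ys)   ≡⟨ delete-++-∉ q xs (p ∷ q ∷ ys) q∉xs ⟩
    xs ++ delete q (p ∷ q ∷ ys)   ≡⟨ cong (xs ++_) (delete-∷-≢ (q ∷ ys) p≢q) ⟩
    xs ++ p ∷ delete q (q ∷ ys)   ≡⟨ cong (λ l → xs ++ p ∷ l) (delete-head q ys (Unique-mid-∉ʳ [ p ] u′)) ⟩
    xs ++ p ∷ ys                  ∎
    where
    open ≡-Reasoning
    u′ = Unique-++⁻ʳ xs u
    q∉xs : q ∉ xs
    q∉xs q∈xs = Unique-++⇒Disjoint xs u (q∈xs , there (here refl))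
    p≢q : p ≢ q
    p≢q p≡q = Unique-mid-∉ʳ [] u′ (here p≡q)

  delete-comm : ∀ (p q : A) l → delete p (delete q l) ≡ delete q (delete p l)
  delete-comm p q []      = refl
  delete-comm p q (x ∷ l) = by-cases (x ≟ p) (x ≟ q)
    where
    open ≡-Reasoning
    by-cases : Dec (x ≡ p) → Dec (x ≡ q) → delete p (delete q (x ∷ l)) ≡ delete q (delete p (x ∷ l))
    by-cases (yes x≡p) (yes x≡q) = begin
      delete p (delete q (x ∷ l))   ≡⟨ cong (delete p) (delete-∷-≡ l x≡q) ⟩
      delete p (delete q l)         ≡⟨ delete-comm p q l ⟩
      delete q (delete p l)         ≡⟨ cong (delete q) (delete-∷-≡ l x≡p) ⟨
      delete q (delete p (x ∷ l))   ∎
    by-cases (yes x≡p) (no x≢q) = begin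
      delete p (delete q (x ∷ l))   ≡⟨ cong (delete p) (delete-∷-≢ l x≢q) ⟩
      delete p (x ∷ delete q l)     ≡⟨ delete-∷-≡ (delete q l) x≡p ⟩
      delete p (delete q l)         ≡⟨ delete-comm p q l ⟩
      delete q (delete p l)         ≡⟨ cong (delete q) (delete-∷-≡ l x≡p) ⟨
      delete q (delete p (x ∷ l))   ∎
    by-cases (no x≢p) (yes x≡q) = begin
      delete p (delete q (x ∷ l))   ≡⟨ cong (delete p) (delete-∷-≡ l x≡q) ⟩
      delete p (delete q l)         ≡⟨ delete-comm p q l ⟩
      delete q (delete p l)         ≡⟨ delete-∷-≡ (delete p l) x≡q ⟨
      delete q (x ∷ delete p l)     ≡⟨ cong (delete q) (delete-∷-≢ l x≢p) ⟨
      delete q (delete p (x ∷ l))   ∎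
    by-cases (no x≢p) (no x≢q) = begin
      delete p (delete q (x ∷ l))   ≡⟨ cong (delete p) (delete-∷-≢ l x≢q) ⟩
      delete p (x ∷ delete q l)     ≡⟨ delete-∷-≢ (delete q l) x≢p ⟩
      x ∷ delete p (delete q l)     ≡⟨ cong (x ∷_) (delete-comm p q l) ⟩
      x ∷ delete q (delete p l)     ≡⟨ delete-∷-≢ (delete p l) x≢q ⟨
      delete q (x ∷ delete p l)     ≡⟨ cong (delete q) (delete-∷-≢ l x≢p) ⟨
      delete q (delete p (x ∷ l))   ∎

  Unique-delete : ∀ (q : A) {l} → Unique l → Unique (delete q l)
  Unique-delete q = Unique-filter⁺ (λ x → ¬? (x ≟ q))

  ∈-delete⁻ : ∀ (q : A) {l x} → x ∈ delete q l → x ∈ l × x ≢ q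
  ∈-delete⁻ q = ∈-filter⁻ (λ x → ¬? (x ≟ q))

  ∈-delete⁺ : ∀ (q : A) {l x} → x ∈ l → x ≢ q → x ∈ delete q l
  ∈-delete⁺ q = ∈-filter⁺ (λ x → ¬? (x ≟ q))

  length-delete : ∀ (q : A) {l} → Unique l → q ∈ l → suc (length (delete q l)) ≡ length l
  length-delete q u q∈l with ∈-∃++ q∈l
  ... | xs , ys , refl rewrite delete-mid xs q ys u | length-++ xs {ys} | length-++ xs {q ∷ ys} =
    sym (ℕ.+-suc (length xs) (length ys))

  length-insert : ∀ xs (p q : A) ys → length (xs ++ p ∷ q ∷ ys) ≡ suc (length (xs ++ p ∷ ys))
  length-insert []       p q ys = refl
  length-insert (_ ∷ xs) p q ys = cong suc (length-insert xs p q ys)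

  cyc-swap-CycAdj : ∀ {c} {p q : A} → Unique c → CycAdj c p q → (cyc c ∘ₚ swap p q) ≈ₚ cyc (delete q c)
  cyc-swap-CycAdj u (inner xs p q ys refl) x =
    trans (cyc-delete xs p q ys u x) (cong (λ l → cyc l x) (sym (delete-next xs p q ys u)))
  cyc-swap-CycAdj {p = p} {q} u (wrap q ys p refl) x = begin
    cyc ((q ∷ ys) ++ [ p ]) (swap p q x)   ≡⟨ cyc-rotate (q ∷ ys) [ p ] u (swap p q x) ⟩
    cyc (p ∷ q ∷ ys) (swap p q x)          ≡⟨ cyc-delete-head p q ys u′ x ⟩
    cyc ([ p ] ++ ys) x                    ≡⟨ cyc-rotate [ p ] ys (Unique-drop₂ u′) x ⟩
    cyc (ys ++ [ p ]) x                    ≡⟨ cong (λ l → cyc l x) (delete-head q _ (Unique[x∷xs]⇒x∉xs u)) ⟨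
    cyc (delete q (q ∷ ys ++ [ p ])) x     ∎
    where
    open ≡-Reasoning
    u′ = Unique-++-comm (q ∷ ys) u

-- Betweenness and consecutive values

module _ {n : ℕ} where
  private
    A = Fin n

  StrictlyBetween-irreflˡ : ∀ (a b : A) → ¬ StrictlyBetween a a b
  StrictlyBetween-irreflˡ a b (inj₁ (a<a , _)) = ℕ.<-irrefl refl a<a
  StrictlyBetween-irreflˡ a b (inj₂ (_ , a<a)) = ℕ.<-irrefl refl a<a

  StrictlyBetween-irreflʳ : ∀ (a b : A) → ¬ StrictlyBetween a b b
  StrictlyBetween-irreflʳ a b (inj₁ (_ , b<b)) = ℕ.<-irrefl refl b<b
  StrictlyBetween-irreflʳ a b (inj₂ (b<b , _)) = ℕ.<-irrefl refl b<b

  StrictlyBetween-shrink : ∀ {p p′ q z : A} → StrictlyBetween p p′ q → StrictlyBetween p′ z q →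
                           StrictlyBetween p z q
  StrictlyBetween-shrink (inj₁ (p<p′ , _))   (inj₁ (p′<z , z<q)) = inj₁ (ℕ.<-trans p<p′ p′<z , z<q)
  StrictlyBetween-shrink (inj₁ (_ , p′<q))   (inj₂ (q<z , z<p′)) = ⊥-elim (ℕ.<-asym p′<q (ℕ.<-trans q<z z<p′))
  StrictlyBetween-shrink (inj₂ (q<p′ , _))   (inj₁ (p′<z , z<q)) = ⊥-elim (ℕ.<-asym q<p′ (ℕ.<-trans p′<z z<q))
  StrictlyBetween-shrink (inj₂ (_ , p′<p))   (inj₂ (q<z , z<p′)) = inj₂ (q<z , ℕ.<-trans z<p′ p′<p)

  StrictlyBetween-split : ∀ (q y x z : A) → z ≢ y → StrictlyBetween q z x →
                          StrictlyBetween q z y ⊎ StrictlyBetween y z x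
  StrictlyBetween-split q y x z z≢y (inj₁ (q<z , z<x)) with <-cmp z y
  ... | tri< z<y _ _ = inj₁ (inj₁ (q<z , z<y))
  ... | tri≈ _ z≡y _ = ⊥-elim (z≢y z≡y)
  ... | tri> _ _ y<z = inj₂ (inj₁ (y<z , z<x))
  StrictlyBetween-split q y x z z≢y (inj₂ (x<z , z<q)) with <-cmp z y
  ... | tri< z<y _ _ = inj₂ (inj₂ (x<z , z<y))
  ... | tri≈ _ z≡y _ = ⊥-elim (z≢y z≡y)
  ... | tri> _ _ y<z = inj₁ (inj₂ (y<z , z<q))

  StrictlyBetween-exclusive : ∀ (x y z : A) → StrictlyBetween x z y → ¬ StrictlyBetween y x z
  StrictlyBetween-exclusive x y z (inj₁ (x<z , z<y)) (inj₁ (y<x , _))   = ℕ.<-asym x<z (ℕ.<-trans z<y y<x)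
  StrictlyBetween-exclusive x y z (inj₁ (x<z , _))   (inj₂ (z<x , _))   = ℕ.<-asym x<z z<x
  StrictlyBetween-exclusive x y z (inj₂ (_ , z<x))   (inj₁ (_ , x<z))   = ℕ.<-asym z<x x<z
  StrictlyBetween-exclusive x y z (inj₂ (y<z , z<x)) (inj₂ (_ , x<y))     = ℕ.<-asym z<x (ℕ.<-trans x<y y<z)

  SomeBetween-⊆ : ∀ {l l′ : List A} {a b} → (∀ {z} → z ∈ l → z ∈ l′) →
                  SomeBetween l a b → SomeBetween l′ a b
  SomeBetween-⊆ l⊆l′ s = let _ , z∈l , between = find s in lose (l⊆l′ z∈l) between

  SomeBetween? : ∀ (c : List A) a b → Dec (SomeBetween c a b)
  SomeBetween? c a b = any? (λ x → ((a <? x) ×-dec (x <? b)) ⊎-dec ((b <? x) ×-dec (x <? a))) c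

  Consecutive : A → A → Set
  Consecutive p q = toℕ q ≡ suc (toℕ p) ⊎ toℕ p ≡ suc (toℕ q)

  suc-≢ : ∀ {i j : A} → toℕ j ≡ suc (toℕ i) → i ≢ j
  suc-≢ e refl = ℕ.1+n≢n (sym e)

  Consecutive-gapless : ∀ {c} {p q : A} → Consecutive p q → ¬ SomeBetween c p q
  Consecutive-gapless p~q s with find s
  ... | z , _ , between = gapless p~q z between
    where
    gapless : ∀ {p q} → Consecutive p q → ∀ z → ¬ StrictlyBetween p z q
    gapless (inj₁ q≡) z (inj₁ (p<z , z<q)) = ℕ.<-irrefl refl (ℕ.<-≤-trans z<q (subst (_≤ toℕ z) (sym q≡) p<z))
    gapless (inj₁ q≡) z (inj₂ (q<z , z<p)) = ℕ.<-asym (ℕ.<-trans q<z z<p) (subst (toℕ _ <_) (sym q≡) (ℕ.n<1+n _))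
    gapless (inj₂ p≡) z (inj₁ (p<z , z<q)) = ℕ.<-asym (ℕ.<-trans p<z z<q) (subst (toℕ _ <_) (sym p≡) (ℕ.n<1+n _))
    gapless (inj₂ p≡) z (inj₂ (q<z , z<p)) = ℕ.<-irrefl refl (ℕ.<-≤-trans z<p (subst (_≤ toℕ z) (sym p≡) q<z))

  Distance : ℕ → A → A → Set
  Distance k p q = toℕ q ≡ suc k + toℕ p ⊎ toℕ p ≡ suc k + toℕ q

  distance : ∀ {p q : A} → p ≢ q → Σ ℕ λ k → Distance k p q
  distance {p} {q} p≢q with <-cmp p q
  ... | tri< p<q _ _ = let k , e = ℕ.m≤n⇒∃[o]m+o≡n p<q in k , inj₁ (trans (sym e) (cong suc (ℕ.+-comm _ k)))
  ... | tri≈ _ p≡q _ = ⊥-elim (p≢q p≡q)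
  ... | tri> _ _ q<p = let k , e = ℕ.m≤n⇒∃[o]m+o≡n q<p in k , inj₂ (trans (sym e) (cong suc (ℕ.+-comm _ k)))

  step-toward : ∀ k {p q : A} → Distance (suc k) p q →
                Σ A λ p′ → Consecutive p p′ × StrictlyBetween p p′ q × Distance k p′ q
  step-toward k {p} {q} (inj₁ q≡) =
    p′ , inj₁ p′≡ , inj₁ (ℕ.≤-reflexive (sym p′≡) , subst (_< toℕ q) (sym p′≡) p+1<q) ,
    inj₁ (trans q≡ (trans (cong suc (sym (ℕ.+-suc k (toℕ p)))) (cong (suc k +_) (sym p′≡))))
    where
    p+1<q : suc (toℕ p) < toℕ q
    p+1<q = subst (suc (toℕ p) <_) (sym q≡) (s≤s (s≤s (ℕ.m≤n+m (toℕ p) k)))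
    p′ = fromℕ< (ℕ.<-trans p+1<q (toℕ<n q))
    p′≡ : toℕ p′ ≡ suc (toℕ p)
    p′≡ = toℕ-fromℕ< _
  step-toward k {p} {q} (inj₂ p≡) =
    p′ , inj₂ p≡1+p′ , inj₂ (q<p′ , ℕ.≤-reflexive (sym p≡1+p′)) , inj₂ p′≡
    where
    k+q<p : suc k + toℕ q < toℕ p
    k+q<p = subst (suc k + toℕ q <_) (sym p≡) (ℕ.n<1+n _)
    p′ = fromℕ< (ℕ.<-trans k+q<p (toℕ<n p))
    p′≡ : toℕ p′ ≡ suc k + toℕ q
    p′≡ = toℕ-fromℕ< _
    p≡1+p′ : toℕ p ≡ suc (toℕ p′)
    p≡1+p′ = trans p≡ (cong suc (sym p′≡))
    q<p′ : q <ᶠ p′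
    q<p′ = subst (toℕ q <_) (sym p′≡) (s≤s (ℕ.m≤n+m (toℕ q) k))

-- Edges of Γ(cS_n) leaving a cycle

module _ {n : ℕ} where
  private
    A = Fin n

  -- b maps the arc of c after j up to i into itself, so b would have two nontrivial orbits.
  swap-splits-cycle : ∀ (i j : A) as bs {b : Perm n} → Unique (j ∷ as ++ i ∷ bs) →
                      b ≈ₚ (cyc (j ∷ as ++ i ∷ bs) ∘ₚ swap i j) → b i ≢ i → b j ≢ j → ¬ InCS b
  swap-splits-cycle i j as bs u b≈ bi≢i bj≢j (inj₁ b≈id) = bi≢i (b≈id i)
  swap-splits-cycle i j as bs {b} u b≈ bi≢i bj≢j (inj₂ (cb , (ucb , _) , b≈cb)) =
    j∉arc (closed-cycle Arc ucb closed i∈cb (∈-++⁺ʳ as (here refl)) j∈cb)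
    where
    c = j ∷ as ++ i ∷ bs
    Arc : A → Set
    Arc x = x ∈ as ++ [ i ]
    i∈cb : i ∈ cb
    i∈cb = cyc-support cb (λ e → bi≢i (trans (b≈cb i) e))
    j∈cb : j ∈ cb
    j∈cb = cyc-support cb (λ e → bj≢j (trans (b≈cb j) e))
    j∉as : j ∉ as
    j∉as j∈as = Unique[x∷xs]⇒x∉xs u (∈-++⁺ˡ j∈as)
    i∉as : i ∉ as
    i∉as = Unique-mid-∉ˡ as (Unique-++⁻ʳ [ j ] u)
    j∉arc : j ∉ as ++ [ i ]
    j∉arc j∈ with ∈-++⁻ as j∈
    ... | inj₁ j∈as        = j∉as j∈as
    ... | inj₂ (here refl) = Unique[x∷xs]⇒x∉xs u (∈-++⁺ʳ as (here refl))
    b-closed : ∀ x → Arc x → Arc (b x)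
    b-closed x x∈arc with ∈-++⁻ as x∈arc
    ... | inj₂ (here refl) = subst Arc (sym b-on-i) (headOr-∈ x as)
      where
      b-on-i : b x ≡ headOr x as
      b-on-i = trans (b≈ x) (trans (cong (cyc c) (swap-≡ˡ x j))
                 (trans (cyc-at [] j (as ++ x ∷ bs) λ ()) (headOr-++ j as x bs)))
    ... | inj₁ x∈as =
      subst Arc (sym (trans (b≈ x) (cong (cyc c) (swap-other i j x x≢i x≢j)))) (cyc-maps-arc j as i bs u x∈as)
      where
      x≢i : x ≢ i
      x≢i refl = i∉as x∈as
      x≢j : x ≢ j
      x≢j refl = j∉as x∈as
    closed : ∀ x → Arc x → Arc (cyc cb x)
    closed x x∈arc = subst Arc (b≈cb x) (b-closed x x∈arc)

  swap-image-outside : ∀ {c} {b : Perm n} (i j : A) → i ≢ j → j ∉ c → b ≈ₚ (cyc c ∘ₚ swap i j) → b i ≡ j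
  swap-image-outside {c} i j i≢j j∉c b≈ = trans (b≈ i) (trans (cong (cyc c) (swap-≡ˡ i j)) (cyc-∉ c j∉c))

  -- b would swap i and j but also move the entries of c, which lie outside {i, j}.
  swap-outside-cycle : ∀ {c} {b : Perm n} (i j : A) → IsCycleList c → i ≢ j → i ∉ c → j ∉ c →
                       b ≈ₚ (cyc c ∘ₚ swap i j) → ¬ InCS b
  swap-outside-cycle i j _ i≢j _ j∉c b≈ (inj₁ b≈id) =
    i≢j (trans (sym (b≈id i)) (swap-image-outside i j i≢j j∉c b≈))
  swap-outside-cycle {c} {b} i j (uc , len) i≢j i∉c j∉c b≈ (inj₂ (cb , (ucb , _) , b≈cb)) =
    y∉ij (closed-cycle (λ x → x ≡ i ⊎ x ≡ j) ucb closed i∈cb (inj₁ refl) y∈cb)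
    where
    b≈′ : b ≈ₚ (cyc c ∘ₚ swap j i)
    b≈′ x = trans (b≈ x) (cong (cyc c) (swap-comm i j x))
    closed : ∀ x → x ≡ i ⊎ x ≡ j → cyc cb x ≡ i ⊎ cyc cb x ≡ j
    closed x (inj₁ refl) = inj₂ (trans (sym (b≈cb x)) (swap-image-outside i j i≢j j∉c b≈))
    closed x (inj₂ refl) = inj₁ (trans (sym (b≈cb x)) (swap-image-outside j i (i≢j ∘ sym) i∉c b≈′))
    i∈cb : i ∈ cb
    i∈cb = cyc-support cb (λ e → i≢j (trans (sym e) (trans (sym (b≈cb i)) (swap-image-outside i j i≢j j∉c b≈))))
    y : A
    y = headOr i c
    y∈c : y ∈ c
    y∈c = headOr-∈-nonempty i len
    y≢i : y ≢ i
    y≢i e = i∉c (subst (_∈ c) e y∈c)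
    y≢j : y ≢ j
    y≢j e = j∉c (subst (_∈ c) e y∈c)
    y∈cb : y ∈ cb
    y∈cb = cyc-support cb λ e →
      cyc-moves uc len y∈c (trans (sym (trans (b≈ y) (cong (cyc c) (swap-other i j y y≢i y≢j)))) (trans (b≈cb y) e))
    y∉ij : ¬ (y ≡ i ⊎ y ≡ j)
    y∉ij (inj₁ e) = y≢i e
    y∉ij (inj₂ e) = y≢j e

  swap-non-adjacent-cycle : ∀ {c} {b : Perm n} (i j : A) → Unique c → i ≢ j → i ∈ c → j ∈ c →
                            cyc c i ≢ j → cyc c j ≢ i → b ≈ₚ (cyc c ∘ₚ swap i j) → ¬ InCS b
  swap-non-adjacent-cycle {c} {b} i j uc i≢j i∈c j∈c ci≢j cj≢i b≈ with ∈-∃++ j∈c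
  ... | xs , ys , refl with Any.++-comm xs (j ∷ ys) i∈c
  ...   | here i≡j = ⊥-elim (i≢j i≡j)
  ...   | there i∈ with ∈-∃++ i∈
  ...     | as , bs , eq = swap-splits-cycle i j as bs u′ b≈′ bi≢i bj≢j
    where
    u′ : Unique (j ∷ as ++ i ∷ bs)
    u′ = subst Unique (cong (j ∷_) eq) (Unique-++-comm xs uc)
    b≈′ : b ≈ₚ (cyc (j ∷ as ++ i ∷ bs) ∘ₚ swap i j)
    b≈′ x = trans (b≈ x) (trans (cyc-rotate xs (j ∷ ys) uc (swap i j x)) (cong (λ l → cyc (j ∷ l) (swap i j x)) eq))
    bi≢i : b i ≢ i
    bi≢i e = cj≢i (trans (sym (trans (b≈ i) (cong (cyc c) (swap-≡ˡ i j)))) e)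
    bj≢j : b j ≢ j
    bj≢j e = ci≢j (trans (sym (trans (b≈ j) (cong (cyc c) (swap-≡ʳ i j i≢j)))) e)

  data CycleStep (c : List A) (b : Perm n) : Set where
    shrink : ∀ {p q} → CycAdj c p q → Consecutive p q → b ≈ₚ cyc (delete q c) → CycleStep c b
    grow   : ∀ xs p q ys → c ≡ xs ++ p ∷ ys → q ∉ c → Consecutive p q →
             b ≈ₚ cyc (xs ++ p ∷ q ∷ ys) → CycleStep c b

  cycle-swap : ∀ {c} {b : Perm n} (i j : A) → IsCycleList c → toℕ j ≡ suc (toℕ i) →
              b ≈ₚ (cyc c ∘ₚ swap i j) → InCS b → CycleStep c b
  cycle-swap {c} {b} i j (uc , len) j≡1+i b≈ ib with any? (i ≟_) c | any? (j ≟_) c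
  ... | yes i∈c | yes j∈c with cyc c i ≟ j | cyc c j ≟ i
  ...   | yes ci≡j | _ = shrink adj (inj₁ j≡1+i) (≈ₚ-trans b≈ (cyc-swap-CycAdj uc adj))
    where adj = subst (CycAdj c i) ci≡j (cyc-CycAdj uc len i∈c)
  ...   | no _ | yes cj≡i = shrink adj (inj₂ j≡1+i)
      (≈ₚ-trans b≈ (≈ₚ-trans (λ x → cong (cyc c) (swap-comm i j x)) (cyc-swap-CycAdj uc adj)))
    where adj = subst (CycAdj c j) cj≡i (cyc-CycAdj uc len j∈c)
  ...   | no ci≢j | no cj≢i = ⊥-elim (swap-non-adjacent-cycle i j uc (suc-≢ j≡1+i) i∈c j∈c ci≢j cj≢i b≈ ib)
  cycle-swap {c} {b} i j (uc , len) j≡1+i b≈ ib | yes i∈c | no j∉c with ∈-∃++ i∈c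
  ... | xs , ys , refl =
    grow xs i j ys refl j∉c (inj₁ j≡1+i) (≈ₚ-trans b≈ (≈ₚ-sym (cyc-insert xs i j ys uc j∉c)))
  cycle-swap {c} {b} i j (uc , len) j≡1+i b≈ ib | no i∉c | yes j∈c with ∈-∃++ j∈c
  ... | xs , ys , refl = grow xs j i ys refl i∉c (inj₂ j≡1+i)
      (≈ₚ-trans b≈ (≈ₚ-trans (λ x → cong (cyc c) (swap-comm i j x)) (≈ₚ-sym (cyc-insert xs j i ys uc i∉c))))
  cycle-swap {c} {b} i j cl j≡1+i b≈ ib | no i∉c | no j∉c =
    ⊥-elim (swap-outside-cycle i j cl (suc-≢ j≡1+i) i∉c j∉c b≈ ib)

  cycle-edge : ∀ {c} {a b : Perm n} → IsCycleList c → a ≈ₚ cyc c → InCS b → Edge a b → CycleStep c b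
  cycle-edge cl a≈ ib (i , j , j≡1+i , b≈) = cycle-swap i j cl j≡1+i (λ x → trans (b≈ x) (a≈ (swap i j x))) ib

-- Reduction moves

module _ {n : ℕ} where
  private
    A = Fin n

  record Removable (c : List A) (q : A) : Set where
    constructor removable
    field
      pred    : A
      adj     : CycAdj c pred q
      gapFree : ¬ SomeBetween c pred q
      long    : 4 ≤ length c

  Move⇒Removable : ∀ {c e : List A} → Unique c → Move c e → Σ A λ q → Removable c q × e ≡ delete q c
  Move⇒Removable u (inner xs a b ys refl gap len) =
    b , removable a (inner xs a b ys refl) gap len , sym (delete-next xs a b ys u)
  Move⇒Removable u (wrap b ys a refl gap len) =
    b , removable a (wrap b ys a refl) gap len , sym (delete-head b _ (Unique[x∷xs]⇒x∉xs u))

  Removable⇒Move : ∀ {c : List A} {q} → Unique c → Removable c q → Move c (delete q c)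
  Removable⇒Move u (removable a (inner xs a b ys refl) gap len) =
    subst (Move _) (sym (delete-next xs a b ys u)) (inner xs a b ys refl gap len)
  Removable⇒Move u (removable a (wrap b ys a refl) gap len) =
    subst (Move _) (sym (delete-head b _ (Unique[x∷xs]⇒x∉xs u))) (wrap b ys a refl gap len)

  Move-long : ∀ {c e : List A} → Move c e → 4 ≤ length c
  Move-long (inner _ _ _ _ _ _ len) = len
  Move-long (wrap _ _ _ _ _ len)    = len

  Move-Unique : ∀ {c e : List A} → Unique c → Move c e → Unique e
  Move-Unique u m with Move⇒Removable u m
  ... | q , _ , refl = Unique-delete q u

  Move-length : ∀ {c e : List A} → Unique c → Move c e → suc (length e) ≡ length c
  Move-length u m with Move⇒Removable u m
  ... | q , removable _ adj _ _ , refl = length-delete q u (proj₂ (CycAdj-∈ adj))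

  ReducesTo-Unique : ∀ {c e : List A} → Unique c → ReducesTo c e → Unique e
  ReducesTo-Unique u ε       = u
  ReducesTo-Unique u (m ◅ r) = ReducesTo-Unique (Move-Unique u m) r

  ReducesTo-length : ∀ {c e : List A} → Unique c → ReducesTo c e → length e ≤ length c
  ReducesTo-length u ε       = ℕ.≤-refl
  ReducesTo-length u (m ◅ r) =
    ℕ.≤-trans (ReducesTo-length (Move-Unique u m) r) (subst (_ ≤_) (Move-length u m) (ℕ.n≤1+n _))

  ReducesTo-3≤ : ∀ {c e : List A} → Unique c → 3 ≤ length c → ReducesTo c e → 3 ≤ length e
  ReducesTo-3≤ u len ε       = len
  ReducesTo-3≤ u len (m ◅ r) =
    ReducesTo-3≤ (Move-Unique u m) (ℕ.≤-pred (subst (4 ≤_) (sym (Move-length u m)) (Move-long m))) r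

  Removable-delete : ∀ {c} {x y : A} → Unique c → 5 ≤ length c → x ≢ y →
                     Removable c x → Removable c y → Removable (delete y c) x
  Removable-delete {c} {x} {y} uc len5 x≢y (removable p p→x gap-px _) (removable q q→y gap-qy _) = by-cases (p ≟ y)
    where
    len4 : 4 ≤ length (delete y c)
    len4 = ℕ.≤-pred (subst (5 ≤_) (sym (length-delete y uc (proj₂ (CycAdj-∈ q→y)))) len5)
    CycAdj-delete : ∀ {r} → r ∈ c → r ≢ y → cyc c (swap q y r) ≡ x → CycAdj (delete y c) r x
    CycAdj-delete {r} r∈c r≢y e =
      subst (CycAdj (delete y c) r) (trans (sym (cyc-swap-CycAdj uc q→y r)) e)
        (cyc-CycAdj (Unique-delete y uc) (ℕ.≤-trans (s≤s (s≤s z≤n)) len4) (∈-delete⁺ y r∈c r≢y))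
    -- If p = y the move removing y makes q the new predecessor of x.
    by-cases : Dec (p ≡ y) → Removable (delete y c) x
    by-cases (no p≢y) =
      removable p (CycAdj-delete p∈c p≢y x≡cp) (gap-px ∘ SomeBetween-⊆ (proj₁ ∘ ∈-delete⁻ y)) len4
      where
      p∈c = proj₁ (CycAdj-∈ p→x)
      p≢q : p ≢ q
      p≢q refl = x≢y (trans (sym (CycAdj⇒cyc uc p→x)) (CycAdj⇒cyc uc q→y))
      x≡cp : cyc c (swap q y p) ≡ x
      x≡cp = trans (cong (cyc c) (swap-other q y p p≢q p≢y)) (CycAdj⇒cyc uc p→x)
    by-cases (yes refl) = removable q (CycAdj-delete q∈c (CycAdj-≢ uc q→y) x≡cq) gap-qx len4
      where
      q∈c = proj₁ (CycAdj-∈ q→y)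
      x≡cq : cyc c (swap q p q) ≡ x
      x≡cq = trans (cong (cyc c) (swap-≡ˡ q p)) (CycAdj⇒cyc uc p→x)
      gap-qx : ¬ SomeBetween (delete p c) q x
      gap-qx s with find s
      ... | z , z∈ , between with ∈-delete⁻ p z∈
      ...   | z∈c , z≢p = [ gap-qy ∘ lose z∈c , gap-px ∘ lose z∈c ]′ (StrictlyBetween-split q p x z z≢p between)

  Normal : List A → Set
  Normal d = ∀ e → ¬ Move d e

  Normal-short : ∀ {d : List A} → length d ≤ 3 → Normal d
  Normal-short short _ m = ⊥-elim (ℕ.<-irrefl refl (ℕ.≤-trans (Move-long m) short))

  ReducesTo3Cycle : List A → Set
  ReducesTo3Cycle c = Σ (List A) λ d → ReducesTo c d × length d ≡ 3

  ReducesTo-short : ∀ {c d : List A} → length c ≤ 3 → ReducesTo c d → c ≡ d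
  ReducesTo-short len ε       = refl
  ReducesTo-short len (m ◅ _) = ⊥-elim (ℕ.<-irrefl refl (ℕ.≤-trans (Move-long m) len))

  -- Normal forms are unique, except that a 4-cycle may reduce to two different 3-cycles.
  Move-confluent : ∀ {c d e : List A} → Unique c → ReducesTo c d → Normal d → Move c e →
                   ReducesTo e d ⊎ (length d ≡ 3 × ReducesTo3Cycle e)
  Move-confluent u ε normal m = ⊥-elim (normal _ m)
  Move-confluent {c} u (m₁ ◅ rest) normal m with Move⇒Removable u m | Move⇒Removable u m₁
  ... | x , rx , refl | y , ry , refl with x ≟ y
  ...   | yes refl = inj₁ rest
  ...   | no x≢y with length c ℕ.≟ 4
  ...     | yes len≡4 = inj₂ (subst (λ l → length l ≡ 3) (ReducesTo-short (ℕ.≤-reflexive len-y) rest) len-y ,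
                              delete x c , ε , len-x)
    where
    len-x : length (delete x c) ≡ 3
    len-x = ℕ.suc-injective (trans (length-delete x u (proj₂ (CycAdj-∈ (Removable.adj rx)))) len≡4)
    len-y : length (delete y c) ≡ 3
    len-y = ℕ.suc-injective (trans (length-delete y u (proj₂ (CycAdj-∈ (Removable.adj ry)))) len≡4)
  ...     | no len≢4 = Sum.map (m₁′ ◅_) (λ (len , d′ , r , l) → len , d′ , m₁′ ◅ r , l)
                         (Move-confluent (Unique-delete y u) rest normal m′)
    where
    len5 = ℕ.≤∧≢⇒< (Removable.long rx) (len≢4 ∘ sym)
    m₁′ : Move (delete x c) (delete y (delete x c))
    m₁′ = Removable⇒Move (Unique-delete x u) (Removable-delete u len5 (x≢y ∘ sym) ry rx)
    m′ : Move (delete y c) (delete y (delete x c))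
    m′ = subst (Move _) (delete-comm x y c) (Removable⇒Move (Unique-delete y u) (Removable-delete u len5 x≢y rx ry))

  ReducesTo3Cycle-Move : ∀ {c e : List A} → Unique c → ReducesTo3Cycle c → Move c e → ReducesTo3Cycle e
  ReducesTo3Cycle-Move u (d , r , len) m with Move-confluent u r (Normal-short (ℕ.≤-reflexive len)) m
  ... | inj₁ r′      = d , r′ , len
  ... | inj₂ (_ , t) = t

  CyclicallyGapped : List A → Set
  CyclicallyGapped d = ∀ a b → CycAdj d a b → SomeBetween d a b

  Normal-gapped : ∀ {d : List A} → CyclicallyGapped d → Normal d
  Normal-gapped g _ (inner xs a b ys eq gapless _) = gapless (g a b (inner xs a b ys eq))
  Normal-gapped g _ (wrap b ys a eq gapless _)     = gapless (g a b (wrap b ys a eq))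

  InnerPair : List A → A → A → Set
  InnerPair l a b = Σ (List A) λ xs → Σ (List A) λ ys → l ≡ xs ++ a ∷ b ∷ ys

  module _ (R : A → A → Set) (R? : ∀ a b → Dec (R a b)) where

    inner-pairs? : ∀ l → (∀ a b → InnerPair l a b → R a b) ⊎ Σ A λ a → Σ A λ b → InnerPair l a b × ¬ R a b
    inner-pairs? []          = inj₁ λ { _ _ ([] , _ , ()) ; _ _ (_ ∷ _ , _ , ()) }
    inner-pairs? (_ ∷ [])    = inj₁ λ { _ _ ([] , _ , ()) ; _ _ (_ ∷ [] , _ , ()) ; _ _ (_ ∷ _ ∷ _ , _ , ()) }
    inner-pairs? (x ∷ y ∷ l) with R? x y | inner-pairs? (y ∷ l)
    ... | no ¬rxy | _ = inj₂ (x , y , ([] , l , refl) , ¬rxy)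
    ... | yes _   | inj₂ (a , b , (xs , ys , eq) , ¬rab) = inj₂ (a , b , (x ∷ xs , ys , cong (x ∷_) eq) , ¬rab)
    ... | yes rxy | inj₁ all = inj₁ λ
      { _ _ ([] , _ , refl) → rxy
      ; a b (_ ∷ xs , ys , eq) → all a b (xs , ys , ∷-injectiveʳ eq) }

  gapped? : ∀ d → CyclicallyGapped d ⊎ Σ A λ a → Σ A λ b → CycAdj d a b × ¬ SomeBetween d a b
  gapped? d with inner-pairs? (SomeBetween d) (SomeBetween? d) d
  ... | inj₂ (a , b , (xs , ys , eq) , gapless) = inj₂ (a , b , inner xs a b ys eq , gapless)
  ... | inj₁ innerGapped = gapped-wrap d innerGapped
    where
    gapped-wrap : ∀ d → (∀ a b → InnerPair d a b → SomeBetween d a b) →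
                  CyclicallyGapped d ⊎ Σ A λ a → Σ A λ b → CycAdj d a b × ¬ SomeBetween d a b
    gapped-wrap []      _ = inj₁ λ { _ _ (inner [] _ _ _ ()) ; _ _ (inner (_ ∷ _) _ _ _ ()) }
    gapped-wrap (h ∷ r) innerGapped with initLast r
    ... | []        = inj₁ λ { _ _ (inner [] _ _ _ ()) ; _ _ (inner (_ ∷ []) _ _ _ ())
                             ; _ _ (inner (_ ∷ _ ∷ _) _ _ _ ()) ; _ _ (wrap _ [] _ ()) ; _ _ (wrap _ (_ ∷ _) _ ()) }
    ... | ys ∷ʳ′ l with SomeBetween? (h ∷ ys ∷ʳ l) l h
    ...   | no gapless = inj₂ (l , h , wrap h ys l refl , gapless)
    ...   | yes gapped = inj₁ λ
      { a b (inner xs a b zs eq) → innerGapped a b (xs , zs , eq)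
      ; a b (wrap b zs a eq) → subst₂ (SomeBetween (h ∷ ys ∷ʳ l))
          (sym (proj₂ (∷ʳ-injective zs ys (sym (∷-injectiveʳ eq))))) (∷-injectiveˡ eq) gapped }

  NormalForm : List A → Set
  NormalForm c = Σ (List A) λ d → ReducesTo c d × (length d ≤ 3 ⊎ CyclicallyGapped d)

  normal-form : ∀ c → Unique c → NormalForm c
  normal-form c = go c (<-wellFounded (length c))
    where
    go : ∀ c → Acc _<_ (length c) → Unique c → NormalForm c
    go c (acc rec) u with length c ℕ.≤? 3 | gapped? c
    ... | yes short | _      = c , ε , inj₁ short
    ... | no _      | inj₁ g = c , ε , inj₂ g
    ... | no long   | inj₂ (a , b , adj , gapless) =
      let d , r , nf = go (delete b c) (rec shorter) (Unique-delete b u) in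
      d , Removable⇒Move u (removable a adj gapless (ℕ.≰⇒> long)) ◅ r , nf
      where
      shorter : length (delete b c) < length c
      shorter = ℕ.≤-reflexive (length-delete b u (proj₂ (CycAdj-∈ adj)))

-- Walks in Γ(cS_n)

module _ {n : ℕ} where
  private
    A = Fin n

  Reach-≈ˡ : ∀ {a a′ b : Perm n} → a ≈ₚ a′ → Reach a′ b → Reach a b
  Reach-≈ˡ a≈ (here a′≈b)                  = here (≈ₚ-trans a≈ a′≈b)
  Reach-≈ˡ a≈ (step ib (i , j , e , b≈) r) = step ib (i , j , e , λ x → trans (b≈ x) (sym (a≈ (swap i j x)))) r

  Reach-≈ʳ : ∀ {a b b′ : Perm n} → Reach a b → b ≈ₚ b′ → Reach a b′
  Reach-≈ʳ (here a≈b)     b≈ = here (≈ₚ-trans a≈b b≈)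
  Reach-≈ʳ (step ib e r) b≈ = step ib e (Reach-≈ʳ r b≈)

  Reach-trans : ∀ {a b c : Perm n} → Reach a b → Reach b c → Reach a c
  Reach-trans (here a≈b)     r′ = Reach-≈ˡ a≈b r′
  Reach-trans (step ib e r) r′ = step ib e (Reach-trans r r′)

  Reach-edge : ∀ {a b : Perm n} → InCS b → Edge a b → Reach a b
  Reach-edge ib e = step ib e (here ≈ₚ-refl)

  Edge-sym : ∀ {a b : Perm n} → Edge a b → Edge b a
  Edge-sym {a} (i , j , e , b≈) =
    i , j , e , λ x → trans (cong a (sym (swap-involutive i j (suc-≢ e) x))) (sym (b≈ (swap i j x)))

  Reach-sym : ∀ {a b : Perm n} → InCS a → Reach a b → Reach b a
  Reach-sym ia (here a≈b)     = here (≈ₚ-sym a≈b)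
  Reach-sym ia (step ib e r) = Reach-trans (Reach-sym ib r) (Reach-edge ia (Edge-sym e))

  Edge-swap : ∀ {a b : Perm n} {p q : A} → Consecutive p q → b ≈ₚ (a ∘ₚ swap p q) → Edge a b
  Edge-swap         {p = p} {q} (inj₁ e) b≈ = p , q , e , b≈
  Edge-swap {a = a} {p = p} {q} (inj₂ e) b≈ = q , p , e , λ x → trans (b≈ x) (cong a (swap-comm p q x))

  Reach-delete-consecutive : ∀ xs (p q : A) ys → Unique (xs ++ p ∷ q ∷ ys) → Consecutive p q →
                             Reach (cyc (xs ++ p ∷ q ∷ ys)) (cyc (xs ++ p ∷ ys))
  Reach-delete-consecutive xs p q ys u p~q =
    Reach-edge (cyc-InCS _ (Unique-drop-next xs u))
      (Edge-swap {a = cyc (xs ++ p ∷ q ∷ ys)} p~q (≈ₚ-sym (cyc-delete xs p q ys u)))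

  -- Detour through the cycle with p′ inserted after p: add p′, remove q (by the hypothesis), remove p′.
  Reach-delete-via : ∀ xs (p p′ q : A) ys → Unique (xs ++ p ∷ q ∷ ys) → p′ ∉ xs ++ p ∷ q ∷ ys →
                     Consecutive p p′ →
                     Reach (cyc ((xs ++ [ p ]) ++ p′ ∷ q ∷ ys)) (cyc ((xs ++ [ p ]) ++ p′ ∷ ys)) →
                     Reach (cyc (xs ++ p ∷ q ∷ ys)) (cyc (xs ++ p ∷ ys))
  Reach-delete-via xs p p′ q ys u p′∉ p~p′ r =
    step (cyc-InCS _ u′) (Edge-swap {a = cyc (xs ++ p ∷ q ∷ ys)} p~p′ (cyc-insert xs p p′ (q ∷ ys) u p′∉))
      (Reach-trans (Reach-≈ˡ (reassoc (p′ ∷ q ∷ ys)) (Reach-≈ʳ r (≈ₚ-sym (reassoc (p′ ∷ ys)))))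
        (Reach-delete-consecutive xs p p′ ys u‴ p~p′))
    where
    reassoc : ∀ zs → cyc (xs ++ p ∷ zs) ≈ₚ cyc ((xs ++ [ p ]) ++ zs)
    reassoc zs x = cong (λ l → cyc l x) (sym (++-assoc xs [ p ] zs))
    u′ : Unique (xs ++ p ∷ p′ ∷ q ∷ ys)
    u′ = Unique-insert xs u p′∉
    u″ : Unique ((xs ++ [ p ]) ++ p′ ∷ q ∷ ys)
    u″ = subst Unique (sym (++-assoc xs [ p ] (p′ ∷ q ∷ ys))) u′
    u‴ : Unique (xs ++ p ∷ p′ ∷ ys)
    u‴ = subst Unique (++-assoc xs [ p ] (p′ ∷ ys)) (Unique-drop-next (xs ++ [ p ]) u″)

  Reach-delete-at-distance : ∀ k xs (p q : A) ys → Unique (xs ++ p ∷ q ∷ ys) →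
                             ¬ SomeBetween (xs ++ p ∷ q ∷ ys) p q → Distance k p q →
                             Reach (cyc (xs ++ p ∷ q ∷ ys)) (cyc (xs ++ p ∷ ys))
  Reach-delete-at-distance zero    xs p q ys u gapless p~q = Reach-delete-consecutive xs p q ys u p~q
  Reach-delete-at-distance (suc k) xs p q ys u gapless dist with step-toward k dist
  ... | p′ , p~p′ , p<p′<q , dist′ =
    Reach-delete-via xs p p′ q ys u p′∉ p~p′
      (Reach-delete-at-distance k (xs ++ [ p ]) p′ q ys u′ gapless′ dist′)
    where
    p′∉ : p′ ∉ xs ++ p ∷ q ∷ ys
    p′∉ p′∈ = gapless (lose p′∈ p<p′<q)
    u′ : Unique ((xs ++ [ p ]) ++ p′ ∷ q ∷ ys)
    u′ = subst Unique (sym (++-assoc xs [ p ] (p′ ∷ q ∷ ys))) (Unique-insert xs u p′∉)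
    gapless′ : ¬ SomeBetween ((xs ++ [ p ]) ++ p′ ∷ q ∷ ys) p′ q
    gapless′ s with find s
    ... | z , z∈ , between with ∈-++⁻ (xs ++ [ p ]) z∈
    ...   | inj₂ (here refl)  = StrictlyBetween-irreflˡ z q between
    ...   | inj₂ (there z∈′) = gapless (lose (∈-++⁺ʳ xs (there z∈′)) (StrictlyBetween-shrink p<p′<q between))
    ...   | inj₁ z∈′ = gapless (lose (subst (z ∈_) (++-assoc xs [ p ] (q ∷ ys)) (∈-++⁺ˡ z∈′))
                                  (StrictlyBetween-shrink p<p′<q between))

  Reach-delete-gapless : ∀ xs (p q : A) ys → Unique (xs ++ p ∷ q ∷ ys) → ¬ SomeBetween (xs ++ p ∷ q ∷ ys) p q →
                         Reach (cyc (xs ++ p ∷ q ∷ ys)) (cyc (xs ++ p ∷ ys))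
  Reach-delete-gapless xs p q ys u gapless =
    Reach-delete-at-distance _ xs p q ys u gapless (proj₂ (distance (CycAdj-≢ u (inner xs p q ys refl))))

  Move-Reach : ∀ {c e : List A} → Unique c → Move c e → Reach (cyc c) (cyc e)
  Move-Reach u (inner xs a b ys refl gapless _) = Reach-delete-gapless xs a b ys u gapless
  Move-Reach u (wrap b ys a refl gapless _) =
    Reach-≈ˡ (cyc-rotate (b ∷ ys) [ a ] u)
      (Reach-≈ʳ (Reach-delete-gapless [] a b ys u′ (gapless ∘ SomeBetween-⊆ (Any.++-comm [ a ] (b ∷ ys))))
        (cyc-rotate [ a ] ys (Unique-drop₂ u′)))
    where
    u′ = Unique-++-comm (b ∷ ys) u

  ReducesTo-Reach : ∀ {c d : List A} → Unique c → ReducesTo c d → Reach (cyc c) (cyc d)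
  ReducesTo-Reach u ε       = here ≈ₚ-refl
  ReducesTo-Reach u (m ◅ r) = Reach-trans (Move-Reach u m) (ReducesTo-Reach (Move-Unique u m) r)

  Reach-2-cycle : ∀ (x y : A) → Unique (x ∷ y ∷ []) → Reach (cyc (x ∷ y ∷ [])) idP
  Reach-2-cycle x y u = Reach-≈ʳ (Reach-delete-gapless [] x y [] u gapless) (cyc-singleton x)
    where
    gapless : ¬ SomeBetween (x ∷ y ∷ []) x y
    gapless (here between)         = StrictlyBetween-irreflˡ x y between
    gapless (there (here between)) = StrictlyBetween-irreflʳ x y between

  -- One of x → y and y → z has no element of the cycle strictly between its endpoints.
  Reach-3-cycle : ∀ (x y z : A) → Unique (x ∷ y ∷ z ∷ []) → Reach (cyc (x ∷ y ∷ z ∷ [])) idP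
  Reach-3-cycle x y z u with SomeBetween? (x ∷ y ∷ z ∷ []) x y
  ... | no gapless = Reach-trans (Reach-delete-gapless [] x y [ z ] u gapless) (Reach-2-cycle x z (Unique-drop₂ u))
  ... | yes s = Reach-trans (Reach-delete-gapless [ x ] y z [] u gapless) (Reach-2-cycle x y (Unique-drop-next [ x ] u))
    where
    z-between : SomeBetween (x ∷ y ∷ z ∷ []) x y → StrictlyBetween x z y
    z-between (here between)                 = ⊥-elim (StrictlyBetween-irreflˡ x y between)
    z-between (there (here between))         = ⊥-elim (StrictlyBetween-irreflʳ x y between)
    z-between (there (there (here between))) = between
    gapless : ¬ SomeBetween (x ∷ y ∷ z ∷ []) y z
    gapless (here between)                 = StrictlyBetween-exclusive x y z (z-between s) between
    gapless (there (here between))         = StrictlyBetween-irreflˡ y z between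
    gapless (there (there (here between))) = StrictlyBetween-irreflʳ y z between

-- The component of the identity

module _ {n : ℕ} where
  private
    A = Fin n

  IdentityCycle : List A → Set
  IdentityCycle c = length c ≡ 2 ⊎ (3 ≤ length c × ReducesTo3Cycle c)

  IdentityComponent : Perm n → Set
  IdentityComponent a =
    a ≈ₚ idP
    ⊎ Σ (List A) (λ c → IsCycleList c × length c ≡ 2 × a ≈ₚ cyc c)
    ⊎ Σ (List A) (λ c → IsCycleList c × 3 ≤ length c × a ≈ₚ cyc c × ReducesTo3Cycle c)

  IdentityCycle⇒IdentityComponent : ∀ {c} {a : Perm n} → IsCycleList c → IdentityCycle c → a ≈ₚ cyc c →
                                    IdentityComponent a
  IdentityCycle⇒IdentityComponent cl (inj₁ len≡2)      a≈ = inj₂ (inj₁ (_ , cl , len≡2 , a≈))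
  IdentityCycle⇒IdentityComponent cl (inj₂ (len≥3 , t)) a≈ = inj₂ (inj₂ (_ , cl , len≥3 , a≈ , t))

  IdentityComponent-≈ : ∀ {a b : Perm n} → a ≈ₚ b → IdentityComponent a → IdentityComponent b
  IdentityComponent-≈ a≈b (inj₁ a≈id) = inj₁ (≈ₚ-trans (≈ₚ-sym a≈b) a≈id)
  IdentityComponent-≈ a≈b (inj₂ (inj₁ (c , cl , len , a≈))) =
    inj₂ (inj₁ (c , cl , len , ≈ₚ-trans (≈ₚ-sym a≈b) a≈))
  IdentityComponent-≈ a≈b (inj₂ (inj₂ (c , cl , len , a≈ , t))) =
    inj₂ (inj₂ (c , cl , len , ≈ₚ-trans (≈ₚ-sym a≈b) a≈ , t))

  IdentityComponent⇒Reach : ∀ {a : Perm n} → IdentityComponent a → Reach idP a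
  IdentityComponent⇒Reach (inj₁ a≈id) = here (≈ₚ-sym a≈id)
  IdentityComponent⇒Reach (inj₂ (inj₁ (x ∷ y ∷ [] , (u , _) , refl , a≈))) =
    Reach-≈ʳ (Reach-sym (cyc-InCS _ u) (Reach-2-cycle x y u)) (≈ₚ-sym a≈)
  IdentityComponent⇒Reach (inj₂ (inj₂ (c , (u , _) , _ , a≈ , d , r , len))) with d | ReducesTo-Unique u r | r | len
  ... | x ∷ y ∷ z ∷ [] | ud | r′ | refl =
    Reach-≈ʳ (Reach-sym (cyc-InCS c u) (Reach-trans (ReducesTo-Reach u r′) (Reach-3-cycle x y z ud))) (≈ₚ-sym a≈)

  IdentityCycle-2≤ : ∀ {c : List A} → IdentityCycle c → 2 ≤ length c
  IdentityCycle-2≤ (inj₁ len≡2)      = ℕ.≤-reflexive (sym len≡2)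
  IdentityCycle-2≤ (inj₂ (len≥3 , _)) = ℕ.≤-trans (ℕ.n≤1+n 2) len≥3

  shrink-IdentityCycle : ∀ {c} {p q : A} → Unique c → IdentityCycle c → CycAdj c p q → Consecutive p q →
                         length (delete q c) ≡ 1 ⊎ IdentityCycle (delete q c)
  shrink-IdentityCycle {c} {p} {q} u idc adj p~q with length-delete q u (proj₂ (CycAdj-∈ adj)) | idc
  ... | len | inj₁ len≡2 = inj₁ (ℕ.suc-injective (trans len len≡2))
  ... | len | inj₂ (len≥3 , t) with length c ℕ.≟ 3
  ...   | yes len≡3 = inj₂ (inj₁ (ℕ.suc-injective (trans len len≡3)))
  ...   | no len≢3  = inj₂ (inj₂ (ℕ.≤-pred (subst (4 ≤_) (sym len) len≥4) , ReducesTo3Cycle-Move u t move))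
    where
    len≥4 = ℕ.≤∧≢⇒< len≥3 (len≢3 ∘ sym)
    move = Removable⇒Move u (removable p adj (Consecutive-gapless p~q) len≥4)

  grow-IdentityCycle : ∀ xs (p q : A) ys → Consecutive p q →
                       IdentityCycle (xs ++ p ∷ ys) → IdentityCycle (xs ++ p ∷ q ∷ ys)
  grow-IdentityCycle xs p q ys p~q (inj₁ len≡2) = inj₂ (ℕ.≤-reflexive (sym len≡3) , _ , ε , len≡3)
    where
    len≡3 = trans (length-insert xs p q ys) (cong suc len≡2)
  grow-IdentityCycle xs p q ys p~q (inj₂ (len≥3 , d , r , len)) =
    inj₂ (ℕ.≤-trans (ℕ.n≤1+n 3) len≥4 , d , inner xs p q ys refl (Consecutive-gapless p~q) len≥4 ◅ r , len)
    where
    len≥4 = subst (4 ≤_) (sym (length-insert xs p q ys)) (s≤s len≥3)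

  CycleStep-IdentityComponent : ∀ {c} {b : Perm n} → IsCycleList c → IdentityCycle c → CycleStep c b →
                                IdentityComponent b
  CycleStep-IdentityComponent {c} (u , _) idc (shrink {q = q} adj p~q b≈) with shrink-IdentityCycle u idc adj p~q
  ... | inj₁ len≡1 = inj₁ (≈ₚ-trans b≈ (cyc-length-1 (delete q c) len≡1))
  ... | inj₂ idc′  = IdentityCycle⇒IdentityComponent (Unique-delete _ u , IdentityCycle-2≤ idc′) idc′ b≈
  CycleStep-IdentityComponent (u , _) idc (grow xs p q ys refl q∉ p~q b≈) =
    IdentityCycle⇒IdentityComponent (Unique-insert xs u q∉ , IdentityCycle-2≤ idc′) idc′ b≈
    where
    idc′ = grow-IdentityCycle xs p q ys p~q idc

  IdentityComponent-Edge : ∀ {a b : Perm n} → IdentityComponent a → InCS b → Edge a b → IdentityComponent b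
  IdentityComponent-Edge (inj₁ a≈id) _ (i , j , e , b≈) =
    inj₂ (inj₁ (i ∷ j ∷ [] , (((suc-≢ e ∷ []) ∷ [] ∷ []) , s≤s (s≤s z≤n)) , refl ,
                λ x → trans (b≈ x) (a≈id (swap i j x))))
  IdentityComponent-Edge (inj₂ (inj₁ (c , cl , len≡2 , a≈))) ib e =
    CycleStep-IdentityComponent cl (inj₁ len≡2) (cycle-edge cl a≈ ib e)
  IdentityComponent-Edge (inj₂ (inj₂ (c , cl , len≥3 , a≈ , t))) ib e =
    CycleStep-IdentityComponent cl (inj₂ (len≥3 , t)) (cycle-edge cl a≈ ib e)

  Reach-IdentityComponent : ∀ {a b : Perm n} → IdentityComponent a → Reach a b → IdentityComponent b
  Reach-IdentityComponent ia (here a≈b)     = IdentityComponent-≈ a≈b ia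
  Reach-IdentityComponent ia (step ib e r) = Reach-IdentityComponent (IdentityComponent-Edge ia ib e) r

-- The other components

module _ {n : ℕ} where
  private
    A = Fin n

  CycleReducingTo : List A → Perm n → Set
  CycleReducingTo d a = Σ (List A) λ c → IsCycleList c × a ≈ₚ cyc c × ReducesTo c d

  CycleStep-ReducingTo : ∀ {c d} {b : Perm n} → Normal d → 4 ≤ length d → IsCycleList c → ReducesTo c d →
                         CycleStep c b → CycleReducingTo d b
  CycleStep-ReducingTo {c} {d} normal len4 (u , _) r (shrink {p} {q} adj p~q b≈) =
    delete q c , (Unique-delete q u , len≥2) , b≈ ,
    [ (λ r′ → r′) , (λ (len≡3 , _) → ⊥-elim (4≰3 len≡3)) ]′ (Move-confluent u r normal m)
    where
    lenc : 4 ≤ length c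
    lenc = ℕ.≤-trans len4 (ReducesTo-length u r)
    m : Move c (delete q c)
    m = Removable⇒Move u (removable p adj (Consecutive-gapless p~q) lenc)
    len≥2 : 2 ≤ length (delete q c)
    len≥2 = ℕ.≤-pred (ℕ.≤-trans (ℕ.n≤1+n 3) (subst (4 ≤_) (sym (Move-length u m)) lenc))
    4≰3 : length d ≢ 3
    4≰3 len≡3 = ℕ.<-irrefl refl (subst (4 ≤_) len≡3 len4)
  CycleStep-ReducingTo normal len4 (u , len≥2) r (grow xs p q ys refl q∉ p~q b≈) =
    xs ++ p ∷ q ∷ ys , (Unique-insert xs u q∉ , ℕ.≤-trans len≥2 longer) , b≈ ,
    inner xs p q ys refl (Consecutive-gapless p~q) (ℕ.≤-trans len4 (ℕ.≤-trans (ReducesTo-length u r) longer)) ◅ r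
    where
    longer : length (xs ++ p ∷ ys) ≤ length (xs ++ p ∷ q ∷ ys)
    longer = ℕ.≤-trans (ℕ.n≤1+n _) (ℕ.≤-reflexive (sym (length-insert xs p q ys)))

  Reach-CycleReducingTo : ∀ {d} {a b : Perm n} → Normal d → 4 ≤ length d →
                          CycleReducingTo d a → Reach a b → CycleReducingTo d b
  Reach-CycleReducingTo normal len4 (c , cl , a≈ , r) (here a≈b) = c , cl , ≈ₚ-trans (≈ₚ-sym a≈b) a≈ , r
  Reach-CycleReducingTo normal len4 (c , cl , a≈ , r) (step ib e rest) =
    Reach-CycleReducingTo normal len4 (CycleStep-ReducingTo normal len4 cl r (cycle-edge cl a≈ ib e)) rest

  classify : ∀ (a : Perm n) → InCS a → IdentityComponent a ⊎ Σ (List A) (λ d → Irreducible d × CycleReducingTo d a)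
  classify a (inj₁ a≈id) = inj₁ (inj₁ a≈id)
  classify a (inj₂ (c , cl@(u , len≥2) , a≈)) with length c ℕ.≟ 2
  ... | yes len≡2 = inj₁ (inj₂ (inj₁ (c , cl , len≡2 , a≈)))
  ... | no len≢2 with normal-form c u
  ...   | d , r , nf with length d ℕ.≤? 3 | nf
  ...     | yes short | _ =
    inj₁ (inj₂ (inj₂ (c , cl , len≥3 , a≈ , d , r , ℕ.≤-antisym short (ReducesTo-3≤ u len≥3 r))))
    where
    len≥3 = ℕ.≤∧≢⇒< len≥2 (len≢2 ∘ sym)
  ...     | no long | inj₁ short  = ⊥-elim (long short)
  ...     | no long | inj₂ gapped = inj₂ (d , (ReducesTo-Unique u r , ℕ.≰⇒> long , gapped) , c , cl , a≈ , r)

  Irreducible-¬Reach-id : ∀ {d} → Irreducible d → ¬ Reach (cyc d) idP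
  Irreducible-¬Reach-id (ud , len4 , gapped) r =
    let _ , cl , id≈c , _ = Reach-CycleReducingTo (Normal-gapped gapped) len4 itself r in cyc-≉id cl id≈c
    where
    itself = _ , (ud , ℕ.≤-trans (s≤s (s≤s z≤n)) len4) , ≈ₚ-refl , ε

  other-component : ∀ (a : Perm n) → InCS a → ¬ Reach idP a →
    Σ (List A) (λ d → Irreducible d
      × (∀ (b : Perm n) → InCS b →
          (Reach a b ⇔
            Σ (List A) (λ c → Σ (List A) (λ c′ →
              IsCycleList c × b ≈ₚ cyc c × ReducesTo c c′ × cyc c′ ≈ₚ cyc d)))))
  other-component a ia ¬id→a with classify a ia
  ... | inj₁ ic = ⊥-elim (¬id→a (IdentityComponent⇒Reach ic))
  ... | inj₂ (d , irr@(_ , len4 , gapped) , ca@(c₀ , (u₀ , _) , a≈ , r₀)) = d , irr , λ b ib → mk⇔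
    (λ a→b → let c , cl , b≈ , r = Reach-CycleReducingTo (Normal-gapped gapped) len4 ca a→b in
             c , d , cl , b≈ , r , ≈ₚ-refl)
    (λ (c , c′ , (u , _) , b≈ , r , c′≈d) →
      Reach-trans (Reach-≈ˡ a≈ (ReducesTo-Reach u₀ r₀))
        (Reach-≈ˡ (≈ₚ-sym c′≈d) (Reach-sym ib (Reach-≈ˡ b≈ (ReducesTo-Reach u r)))))

-- Connectedness

Far : ℕ → ℕ → Set
Far u v = suc u < v ⊎ suc v < u

Far-sym : ∀ {u v} → Far u v → Far v u
Far-sym (inj₁ u+1<v) = inj₂ u+1<v
Far-sym (inj₂ v+1<u) = inj₁ v+1<u

Far-1 : ∀ v → v < 4 → Far 1 v → v ≡ 3
Far-1 0 _ (inj₂ (s≤s ()))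
Far-1 1 _ (inj₁ (s≤s ()))
Far-1 1 _ (inj₂ (s≤s ()))
Far-1 2 _ (inj₁ (s≤s (s≤s ())))
Far-1 2 _ (inj₂ (s≤s ()))
Far-1 3 _ _ = refl
Far-1 (suc (suc (suc (suc _)))) (s≤s (s≤s (s≤s (s≤s ())))) _

Far-2 : ∀ v → v < 4 → Far 2 v → v ≡ 0
Far-2 0 _ _ = refl
Far-2 1 _ (inj₁ (s≤s ()))
Far-2 1 _ (inj₂ (s≤s (s≤s ())))
Far-2 2 _ (inj₁ (s≤s (s≤s ())))
Far-2 2 _ (inj₂ (s≤s (s≤s ())))
Far-2 3 _ (inj₁ (s≤s (s≤s (s≤s ()))))
Far-2 3 _ (inj₂ (s≤s (s≤s ())))
Far-2 (suc (suc (suc (suc _)))) (s≤s (s≤s (s≤s (s≤s ())))) _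

Far-twice : ∀ u v w → u < 4 → v < 4 → w < 4 → v ≢ w → Far u v → Far u w → u ≡ 0 ⊎ u ≡ 3
Far-twice 0 v w _ _  _  _   _    _    = inj₁ refl
Far-twice 1 v w _ v<4 w<4 v≢w fv fw = ⊥-elim (v≢w (trans (Far-1 v v<4 fv) (sym (Far-1 w w<4 fw))))
Far-twice 2 v w _ v<4 w<4 v≢w fv fw = ⊥-elim (v≢w (trans (Far-2 v v<4 fv) (sym (Far-2 w w<4 fw))))
Far-twice 3 v w _ _  _  _   _    _    = inj₂ refl
Far-twice (suc (suc (suc (suc _)))) v w (s≤s (s≤s (s≤s (s≤s ())))) _ _ _ _ _

no-three-extremes : ∀ {u v w : ℕ} → u ≢ v → v ≢ w → u ≢ w →
                    u ≡ 0 ⊎ u ≡ 3 → v ≡ 0 ⊎ v ≡ 3 → w ≡ 0 ⊎ w ≡ 3 → ⊥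
no-three-extremes u≢v v≢w u≢w (inj₁ refl) (inj₁ refl) _           = u≢v refl
no-three-extremes u≢v v≢w u≢w (inj₂ refl) (inj₂ refl) _           = u≢v refl
no-three-extremes u≢v v≢w u≢w (inj₁ refl) (inj₂ refl) (inj₁ refl) = u≢w refl
no-three-extremes u≢v v≢w u≢w (inj₁ refl) (inj₂ refl) (inj₂ refl) = v≢w refl
no-three-extremes u≢v v≢w u≢w (inj₂ refl) (inj₁ refl) (inj₁ refl) = v≢w refl
no-three-extremes u≢v v≢w u≢w (inj₂ refl) (inj₁ refl) (inj₂ refl) = u≢w refl

module _ {n : ℕ} where
  private
    A = Fin n

  SomeBetween⇒Far : ∀ {d} {a b : A} → SomeBetween d a b → Far (toℕ a) (toℕ b)
  SomeBetween⇒Far s with find s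
  ... | _ , _ , inj₁ (a<z , z<b) = inj₁ (ℕ.<-≤-trans (s≤s a<z) z<b)
  ... | _ , _ , inj₂ (b<z , z<a) = inj₂ (ℕ.<-≤-trans (s≤s b<z) z<a)

  gapped-extreme : n ≤ 4 → ∀ {d} {a x b : A} → CyclicallyGapped d → CycAdj d a x → CycAdj d x b → a ≢ b →
                   toℕ x ≡ 0 ⊎ toℕ x ≡ 3
  gapped-extreme n≤4 {a = a} {x} {b} g a→x x→b a≢b =
    Far-twice (toℕ x) (toℕ a) (toℕ b) (bound x) (bound a) (bound b) (a≢b ∘ toℕ-injective)
      (Far-sym (SomeBetween⇒Far (g a x a→x))) (SomeBetween⇒Far (g x b x→b))
    where
    bound : ∀ (y : A) → toℕ y < 4
    bound y = ℕ.<-≤-trans (toℕ<n y) n≤4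

  -- x₁, x₂ and x₃ would be three distinct extremes.
  no-gapped-run : n ≤ 4 → ∀ {d} {x₀ x₁ x₂ x₃ x₄ : A} → CyclicallyGapped d →
                  Unique (x₀ ∷ x₁ ∷ x₂ ∷ x₃ ∷ []) → x₂ ≢ x₄ →
                  CycAdj d x₀ x₁ → CycAdj d x₁ x₂ → CycAdj d x₂ x₃ → CycAdj d x₃ x₄ → ⊥
  no-gapped-run n≤4 g u x₂≢x₄ x₀→x₁ x₁→x₂ x₂→x₃ x₃→x₄ =
    no-three-extremes (head-≢ᶠ (here refl) u₁) (head-≢ᶠ (here refl) u₂) (head-≢ᶠ (there (here refl)) u₁)
      (gapped-extreme n≤4 g x₀→x₁ x₁→x₂ (head-≢ (there (here refl)) u))
      (gapped-extreme n≤4 g x₁→x₂ x₂→x₃ (head-≢ (there (here refl)) u₁))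
      (gapped-extreme n≤4 g x₂→x₃ x₃→x₄ x₂≢x₄)
    where
    u₁ = Unique-++⁻ʳ (_ ∷ []) u
    u₂ = Unique-++⁻ʳ (_ ∷ _ ∷ []) u
    head-≢ : ∀ {y z : A} {l} → z ∈ l → Unique (y ∷ l) → y ≢ z
    head-≢ z∈l u refl = Unique[x∷xs]⇒x∉xs u z∈l
    head-≢ᶠ : ∀ {y z : A} {l} → z ∈ l → Unique (y ∷ l) → toℕ y ≢ toℕ z
    head-≢ᶠ z∈l u = head-≢ z∈l u ∘ toℕ-injective

  ¬Irreducible : n ≤ 4 → ∀ (d : List A) → ¬ Irreducible d
  ¬Irreducible n≤4 (_ ∷ [])         (_ , s≤s () , _)
  ¬Irreducible n≤4 (_ ∷ _ ∷ [])     (_ , s≤s (s≤s ()) , _)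
  ¬Irreducible n≤4 (_ ∷ _ ∷ _ ∷ []) (_ , s≤s (s≤s (s≤s ())) , _)
  ¬Irreducible n≤4 (x₀ ∷ x₁ ∷ x₂ ∷ x₃ ∷ []) (u , _ , g) =
    no-gapped-run n≤4 g (Unique-++⁻ˡ (_ ∷ _ ∷ _ ∷ _ ∷ []) u)
      (λ x₂≡x₀ → Unique[x∷xs]⇒x∉xs u (there (here (sym x₂≡x₀))))
      (inner [] _ _ _ refl) (inner (_ ∷ []) _ _ _ refl) (inner (_ ∷ _ ∷ []) _ _ _ refl) (wrap _ (_ ∷ _ ∷ []) _ refl)
  ¬Irreducible n≤4 (x₀ ∷ x₁ ∷ x₂ ∷ x₃ ∷ y ∷ rest) (u , _ , g) =
    no-gapped-run n≤4 g (Unique-++⁻ˡ (_ ∷ _ ∷ _ ∷ _ ∷ []) u)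
      (λ x₂≡y → Unique[x∷xs]⇒x∉xs (Unique-++⁻ʳ (_ ∷ _ ∷ []) u) (there (here x₂≡y)))
      (inner [] _ _ _ refl) (inner (_ ∷ []) _ _ _ refl) (inner (_ ∷ _ ∷ []) _ _ _ refl) (inner (_ ∷ _ ∷ _ ∷ []) _ _ _ refl)

module _ (m : ℕ) where

  pentagram : List (Fin (5 + m))
  pentagram = # 0 ∷ # 2 ∷ # 4 ∷ # 1 ∷ # 3 ∷ []

  pentagram-Irreducible : Irreducible pentagram
  pentagram-Irreducible = u , s≤s (s≤s (s≤s (s≤s z≤n))) , gapped
    where
    u : Unique pentagram
    u = from-yes (UniqueDec.unique? _≟_ pentagram)
    gap : ∀ a → a ∈ pentagram → SomeBetween pentagram a (cyc pentagram a)
    gap a (here refl)                                 = from-yes (SomeBetween? pentagram a (cyc pentagram a))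
    gap a (there (here refl))                         = from-yes (SomeBetween? pentagram a (cyc pentagram a))
    gap a (there (there (here refl)))                 = from-yes (SomeBetween? pentagram a (cyc pentagram a))
    gap a (there (there (there (here refl))))         = from-yes (SomeBetween? pentagram a (cyc pentagram a))
    gap a (there (there (there (there (here refl))))) = from-yes (SomeBetween? pentagram a (cyc pentagram a))
    gapped : CyclicallyGapped pentagram
    gapped a b adj = subst (SomeBetween pentagram a) (CycAdj⇒cyc u adj) (gap a (proj₁ (CycAdj-∈ adj)))

connected⇒≤4 : ∀ n → GammaConnected n → n ≤ 4
connected⇒≤4 n connected with n ℕ.≤? 4
... | yes n≤4 = n≤4
... | no n≰4 with ℕ.≰⇒> n≰4
...   | s≤s (s≤s (s≤s (s≤s (s≤s (z≤n {m}))))) =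
  ⊥-elim (Irreducible-¬Reach-id irr (connected _ idP (cyc-InCS _ (proj₁ irr)) (inj₁ ≈ₚ-refl)))
  where
  irr = pentagram-Irreducible m

≤4⇒connected : ∀ n → n ≤ 4 → GammaConnected n
≤4⇒connected n n≤4 a b ia ib = Reach-trans (Reach-sym (inj₁ ≈ₚ-refl) (id-reaches a ia)) (id-reaches b ib)
  where
  id-reaches : ∀ a → InCS a → Reach idP a
  id-reaches a ia = [ IdentityComponent⇒Reach , (λ (d , irr , _) → ⊥-elim (¬Irreducible n≤4 d irr)) ]′ (classify a ia)

proposition5p4 : (n : ℕ) →
    (GammaConnected n ⇔ n ≤ 4)
    × (∀ (a : Perm n) → InCS a →
         (Reach idP a ⇔
           (a ≈ₚ idP
            ⊎ Σ (List (Fin n)) (λ c → IsCycleList c × length c ≡ 2 × a ≈ₚ cyc c)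
            ⊎ Σ (List (Fin n)) (λ c → IsCycleList c × 3 ≤ length c × a ≈ₚ cyc c
                × Σ (List (Fin n)) (λ d → ReducesTo c d × length d ≡ 3)))))
    × (∀ (a : Perm n) → InCS a → ¬ Reach idP a →
         Σ (List (Fin n)) (λ d → Irreducible d
           × (∀ (b : Perm n) → InCS b →
               (Reach a b ⇔
                 Σ (List (Fin n)) (λ c → Σ (List (Fin n)) (λ c' →
                   IsCycleList c × b ≈ₚ cyc c × ReducesTo c c' × cyc c' ≈ₚ cyc d))))))
proposition5p4 n =
  mk⇔ (connected⇒≤4 n) (≤4⇒connected n) ,
  (λ a _ → mk⇔ (Reach-IdentityComponent (inj₁ ≈ₚ-refl)) IdentityComponent⇒Reach) ,
  other-component
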